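{- Let $G$ be a graph of maximum degree at most $3$. Then $R(G)\geq \left(\frac{1}{\sqrt{3}}+\frac{1}{3}\right)\alpha'(G)$, and equality holds if and only if the graph obtained from $G$ by removing all isolated vertices is of the form $H\circ K_1$ for some $2$-regular graph $H$.
   Context: All graphs are finite and simple. For a graph $G$, the Randić index is $R(G)=\sum_{uv\in E(G)} \frac{1}{\sqrt{d(u)d(v)}}$, where $d(\cdot)$ denotes degree in $G$. $\alpha'(G)$ denotes the matching number of $G$. For a graph $H$, the corona product $H\circ K_1$ is the graph obtained from $H$ by adding, for each vertex $v$ of $H$, a new vertex adjacent only to $v$ (i.e. attaching one pendant edge at every vertex of $H$). -}

module Defs where

open import Data.Bool using (Bool; true; false; if_then_else_; _∧_; not; T)
open import Data.Nat as ℕ using (ℕ; zero; suc)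
open import Data.Integer using (+_)
open import Data.Rational as ℚ using (ℚ; 0ℚ; 1ℚ; _≤ᵇ_)
open import Data.Fin using (Fin; toℕ)
open import Data.Fin.Properties using (_≟_)
open import Data.List using (List; []; _∷_; map; foldr; length; concatMap)
open import Data.List.Base using (allFin)
open import Data.List.Relation.Unary.All using (All)
open import Data.List.Relation.Unary.Unique.Propositional using (Unique)
open import Data.Product using (Σ; _×_; _,_; ∃)
open import Data.Sum using (_⊎_; inj₁; inj₂)
open import Relation.Binary.PropositionalEquality using (_≡_; _≢_)
open import Relation.Nullary.Decidable using (⌊_⌋)
open import Function.Definitions using (Injective)

record Graph (n : ℕ) : Set where
  field
    adj     : Fin n → Fin n → Bool
    adj-sym : ∀ u v → adj u v ≡ adj v u
    adj-irr : ∀ v → adj v v ≡ false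
open Graph public

deg : ∀ {n} → Graph n → Fin n → ℕ
deg G v = foldr (λ j acc → if adj G v j then suc acc else acc) 0 (allFin _)

MaxDegreeAtMost : ∀ {n} → Graph n → ℕ → Set
MaxDegreeAtMost G Δ = ∀ v → deg G v ℕ.≤ Δ

Regular : ∀ {n} → Graph n → ℕ → Set
Regular G r = ∀ v → deg G v ≡ r

endpoints : ∀ {n} → List (Fin n × Fin n) → List (Fin n)
endpoints = concatMap (λ { (u , v) → u ∷ v ∷ [] })

IsMatching : ∀ {n} → Graph n → List (Fin n × Fin n) → Set
IsMatching G M = All (λ { (u , v) → adj G u v ≡ true }) M × Unique (endpoints M)

IsMatchingNumber : ∀ {n} → Graph n → ℕ → Set
IsMatchingNumber G k =
  (Σ (List _) λ M → IsMatching G M × length M ≡ k)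
  × (∀ M → IsMatching G M → length M ℕ.≤ k)

-- The real field ℚ(√2,√3), represented exactly.
-- Q2 : p + q√2 ;  K : x + y√3  with x y : Q2
-- (so an element of K is a + b√2 + c√3 + d√6 with a b c d : ℚ).
-- Data.Rational values are normalised, so _≡_ on K is equality of reals
-- ({1,√2,√3,√6} is a ℚ-basis).

record Q2 : Set where
  constructor q2
  field p q : ℚ

record K : Set where
  constructor k3
  field x y : Q2

_+₂_ : Q2 → Q2 → Q2
q2 a b +₂ q2 c d = q2 (a ℚ.+ c) (b ℚ.+ d)

-₂_ : Q2 → Q2
-₂ q2 a b = q2 (ℚ.- a) (ℚ.- b)

_*₂_ : Q2 → Q2 → Q2
q2 a b *₂ q2 c d = q2 (a ℚ.* c ℚ.+ (+ 2 ℚ./ 1) ℚ.* b ℚ.* d) (a ℚ.* d ℚ.+ b ℚ.* c)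

nonneg₂ : Q2 → Bool
nonneg₂ (q2 a b) with 0ℚ ≤ᵇ a | 0ℚ ≤ᵇ b
... | true  | true  = true
... | true  | false = (+ 2 ℚ./ 1) ℚ.* b ℚ.* b ≤ᵇ a ℚ.* a
... | false | true  = a ℚ.* a ≤ᵇ (+ 2 ℚ./ 1) ℚ.* b ℚ.* b
... | false | false = false

three₂ : Q2
three₂ = q2 (+ 3 ℚ./ 1) 0ℚ

nonnegK : K → Bool
nonnegK (k3 x y) with nonneg₂ x | nonneg₂ y
... | true  | true  = true
... | true  | false = nonneg₂ ((x *₂ x) +₂ (-₂ (three₂ *₂ (y *₂ y))))
... | false | true  = nonneg₂ ((three₂ *₂ (y *₂ y)) +₂ (-₂ (x *₂ x)))
... | false | false = false

0K : K
0K = k3 (q2 0ℚ 0ℚ) (q2 0ℚ 0ℚ)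

_+K_ : K → K → K
k3 a b +K k3 c d = k3 (a +₂ c) (b +₂ d)

-K_ : K → K
-K k3 a b = k3 (-₂ a) (-₂ b)

_≤K_ : K → K → Set
a ≤K b = T (nonnegK (b +K (-K a)))

_·K_ : ℕ → K → K
zero  ·K a = 0K
suc k ·K a = a +K (k ·K a)

ofℚ : ℚ → K
ofℚ r = k3 (q2 r 0ℚ) (q2 0ℚ 0ℚ)

-- 1/√(d₁ d₂) for degrees d₁ d₂ ∈ {1,2,3}:
--   1/√1 = 1, 1/√2 = √2/2, 1/√3 = √3/3, 1/√4 = 1/2, 1/√6 = √6/6, 1/√9 = 1/3.
-- Other arguments never occur for graphs of maximum degree ≤ 3
-- (endpoints of an edge have degree ≥ 1); they are given the value 0.
invSqrtProd : ℕ → ℕ → K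
invSqrtProd d₁ d₂ = go (d₁ ℕ.* d₂)
  where
  go : ℕ → K
  go 1 = ofℚ 1ℚ
  go 2 = k3 (q2 0ℚ (+ 1 ℚ./ 2)) (q2 0ℚ 0ℚ)
  go 3 = k3 (q2 0ℚ 0ℚ) (q2 (+ 1 ℚ./ 3) 0ℚ)
  go 4 = ofℚ (+ 1 ℚ./ 2)
  go 6 = k3 (q2 0ℚ 0ℚ) (q2 0ℚ (+ 1 ℚ./ 6))
  go 9 = ofℚ (+ 1 ℚ./ 3)
  go _ = 0K

randic : ∀ {n} → Graph n → K
randic {n} G =
  foldr (λ u acc → foldr (λ v acc' →
           if (toℕ u ℕ.<ᵇ toℕ v) ∧ adj G u v
           then invSqrtProd (deg G u) (deg G v) +K acc'
           else acc') acc (allFin n)) 0K (allFin n)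

c₃ : K
c₃ = k3 (q2 (+ 1 ℚ./ 3) 0ℚ) (q2 (+ 1 ℚ./ 3) 0ℚ)

-- Corona product H ∘ K₁ on the vertex set Fin m ⊎ Fin m
-- (inj₁ v : vertex v of H,  inj₂ v : the pendant vertex attached to v)

coronaAdj : ∀ {m} → Graph m → Fin m ⊎ Fin m → Fin m ⊎ Fin m → Bool
coronaAdj H (inj₁ u) (inj₁ v) = adj H u v
coronaAdj H (inj₁ u) (inj₂ v) = ⌊ u ≟ v ⌋
coronaAdj H (inj₂ u) (inj₁ v) = ⌊ u ≟ v ⌋
coronaAdj H (inj₂ u) (inj₂ v) = false

NonIsolatedPartIsCoronaOf2Regular : ∀ {n} → Graph n → Set
NonIsolatedPartIsCoronaOf2Regular {n} G =
  Σ ℕ λ m → Σ (Graph m) λ H → Regular H 2 ×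
  (Σ (Fin m ⊎ Fin m → Fin n) λ f →
      Injective _≡_ _≡_ f
    × (∀ a → deg G (f a) ≢ 0)
    × (∀ v → deg G v ≢ 0 → ∃ λ a → f a ≡ v)
    × (∀ a b → adj G (f a) (f b) ≡ coronaAdj H a b))

module Submission where

-- Fix a maximum matching M, so that every edge has a matched endpoint, and discharge the
-- weight 1/√(d(u)d(v)) of each edge onto its matched endpoints: all of it if only one is
-- matched, split according to the table `share` if both are.  Then R(G) is the sum, over
-- the edges ab of M, of what a and b receive.  Since Δ ≤ 3, every further edge at a matched
-- vertex of degree d brings it at least `minCharge d`, and a finite check over the degrees of
-- a and b shows that ab receives at least 1/√3 + 1/3, strictly more unless one endpoint is a
-- leaf and the other has degree 3 with both further neighbours matched and of degree 3.  If
-- equality holds, these degree-3 centres span a 2-regular graph H and the non-isolated part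
-- of G is H ∘ K₁; conversely, the pendant edges of H ∘ K₁ form a maximum matching on which
-- every bound is attained.  All numbers live in ℚ(√2, √3), ordered by iterating the sign
-- test of a real quadratic extension of an ordered domain.

open import Defs
open import Data.Nat using (ℕ)
open import Relation.Binary.PropositionalEquality using (_≡_)
open import Function.Bundles using (_⇔_)
open import Data.Product using (_×_)
open import Data.List using (length)
open import Data.Nat using (_≤_)
open import Data.Nat.Properties using (≤-antisym)
open import Data.Product using (_,_)
open import Function.Bundles using (mk⇔)
open import Relation.Binary.PropositionalEquality using (sym; trans; cong; subst)

module OrderedDomains where

  open import Level using (0ℓ)
  open import Algebra.Bundles using (CommutativeRing; RawRing)
  open import Algebra.Structures using (IsCommutativeRing)
  import Algebra.Properties.Ring as RingProperties
  import Algebra.Properties.Semiring.Mult as SemiringMult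
  import Algebra.Solver.Ring
  import Algebra.Solver.Ring.AlmostCommutativeRing as ACR
  open import Data.Bool using (Bool; T; T?)
  open import Data.Empty using (⊥; ⊥-elim)
  open import Data.Integer as ℤ using (ℤ; -[1+_])
  import Data.Integer.Properties as ℤ
  open import Data.Maybe using (Maybe; just; nothing)
  open import Data.Nat as ℕ using (ℕ; zero; suc)
  import Data.Nat.Properties as ℕ
  open import Data.Product using (_×_; _,_; proj₂)
  open import Data.Sign as Sign using (Sign)
  open import Data.Sum as Sum using (_⊎_; inj₁; inj₂)
  open import Relation.Binary.PropositionalEquality
  open import Relation.Nullary using (¬_; Dec; yes; no)
  open import Relation.Nullary.Decidable using (decidable-stable)

  record DecOrderedDomain : Set₁ where
    infixl 6 _+_
    infixl 7 _*_
    infix 8 -_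
    field
      Carrier : Set
      _+_ _*_ : Carrier → Carrier → Carrier
      -_ : Carrier → Carrier
      0# 1# : Carrier
      isCommutativeRing : IsCommutativeRing _≡_ _+_ _*_ -_ 0# 1#
      nonnegᵇ : Carrier → Bool
      +-nonneg : ∀ {x y} → T (nonnegᵇ x) → T (nonnegᵇ y) → T (nonnegᵇ (x + y))
      *-nonneg : ∀ {x y} → T (nonnegᵇ x) → T (nonnegᵇ y) → T (nonnegᵇ (x * y))
      nonneg-total : ∀ x → T (nonnegᵇ x) ⊎ T (nonnegᵇ (- x))
      nonneg-antisym : ∀ {x} → T (nonnegᵇ x) → T (nonnegᵇ (- x)) → x ≡ 0#
      noZeroDivisors : ∀ {x y} → x * y ≡ 0# → x ≡ 0# ⊎ y ≡ 0#

  module DecOrderedDomainProperties (R : DecOrderedDomain) where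
    open DecOrderedDomain R public

    commutativeRing : CommutativeRing 0ℓ 0ℓ
    commutativeRing = record { isCommutativeRing = isCommutativeRing }

    open CommutativeRing commutativeRing public
      using (ring; semiring; +-assoc; +-comm; +-identityˡ; +-identityʳ; -‿inverseʳ; zeroˡ)
    open RingProperties ring public
      using (-0#≈0#; -‿involutive; -‿+-comm; -‿distribˡ-*; -‿distribʳ-*; +-inverseʳ-unique)
    open SemiringMult semiring using (×-homo-+; ×1-homo-*) renaming (_×_ to _·_)

    infixl 6 _-_
    _-_ : Carrier → Carrier → Carrier
    x - y = x + - y

    NonNeg : Carrier → Set
    NonNeg x = T (nonnegᵇ x)

    -- ℤ maps into R, so the ring solver can be run with integer coefficients.
    ⟦_⟧ℤ : ℤ → Carrier
    ⟦ ℤ.+ n ⟧ℤ = n · 1#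
    ⟦ -[1+ n ] ⟧ℤ = - (suc n · 1#)

    private
      signed : Sign → Carrier → Carrier
      signed Sign.+ x = x
      signed Sign.- x = - x

      ⟦◃⟧ : ∀ s n → ⟦ s ℤ.◃ n ⟧ℤ ≡ signed s (n · 1#)
      ⟦◃⟧ Sign.+ zero = refl
      ⟦◃⟧ Sign.- zero = sym -0#≈0#
      ⟦◃⟧ Sign.+ (suc n) = refl
      ⟦◃⟧ Sign.- (suc n) = refl

      signed-* : ∀ s t x y → signed (s Sign.* t) (x * y) ≡ signed s x * signed t y
      signed-* Sign.+ Sign.+ x y = refl
      signed-* Sign.+ Sign.- x y = -‿distribʳ-* x y
      signed-* Sign.- Sign.+ x y = -‿distribˡ-* x y
      signed-* Sign.- Sign.- x y = begin
        x * y          ≡⟨ sym (-‿involutive (x * y)) ⟩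
        - - (x * y)    ≡⟨ cong -_ (-‿distribʳ-* x y) ⟩
        - (x * - y)    ≡⟨ -‿distribˡ-* x (- y) ⟩
        - x * - y      ∎
        where open ≡-Reasoning

      ⟦⟧-signAbs : ∀ i → ⟦ i ⟧ℤ ≡ signed (ℤ.sign i) (ℤ.∣ i ∣ · 1#)
      ⟦⟧-signAbs i = trans (cong ⟦_⟧ℤ (sym (ℤ.◃-inverse i))) (⟦◃⟧ (ℤ.sign i) ℤ.∣ i ∣)

      *-homo : ∀ i j → ⟦ i ℤ.* j ⟧ℤ ≡ ⟦ i ⟧ℤ * ⟦ j ⟧ℤ
      *-homo i j = begin
        ⟦ i ℤ.* j ⟧ℤ
          ≡⟨ ⟦◃⟧ (sᵢ Sign.* sⱼ) (ℤ.∣ i ∣ ℕ.* ℤ.∣ j ∣) ⟩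
        signed (sᵢ Sign.* sⱼ) ((ℤ.∣ i ∣ ℕ.* ℤ.∣ j ∣) · 1#)
          ≡⟨ cong (signed (sᵢ Sign.* sⱼ)) (×1-homo-* ℤ.∣ i ∣ ℤ.∣ j ∣) ⟩
        signed (sᵢ Sign.* sⱼ) ((ℤ.∣ i ∣ · 1#) * (ℤ.∣ j ∣ · 1#))
          ≡⟨ signed-* sᵢ sⱼ _ _ ⟩
        signed sᵢ (ℤ.∣ i ∣ · 1#) * signed sⱼ (ℤ.∣ j ∣ · 1#)
          ≡⟨ sym (cong₂ _*_ (⟦⟧-signAbs i) (⟦⟧-signAbs j)) ⟩
        ⟦ i ⟧ℤ * ⟦ j ⟧ℤ ∎
        where
        open ≡-Reasoning
        sᵢ = ℤ.sign i
        sⱼ = ℤ.sign j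

      ⊖-homo : ∀ m n → ⟦ m ℤ.⊖ n ⟧ℤ ≡ m · 1# - n · 1#
      ⊖-homo zero zero = sym (trans (cong (0# +_) -0#≈0#) (+-identityˡ 0#))
      ⊖-homo (suc m) zero = sym (trans (cong (suc m · 1# +_) -0#≈0#) (+-identityʳ _))
      ⊖-homo zero (suc n) = sym (+-identityˡ _)
      ⊖-homo (suc m) (suc n) = begin
        ⟦ suc m ℤ.⊖ suc n ⟧ℤ        ≡⟨ cong ⟦_⟧ℤ (ℤ.[1+m]⊖[1+n]≡m⊖n m n) ⟩
        ⟦ m ℤ.⊖ n ⟧ℤ                ≡⟨ ⊖-homo m n ⟩
        a - b                       ≡⟨ cong (_- b) (sym (+-identityˡ a)) ⟩
        (0# + a) - b                ≡⟨ cong (λ z → (z + a) - b) (sym (-‿inverseʳ 1#)) ⟩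
        ((1# - 1#) + a) - b         ≡⟨ cong (_- b) (+-assoc 1# (- 1#) a) ⟩
        (1# + (- 1# + a)) - b       ≡⟨ cong (λ z → (1# + z) - b) (+-comm (- 1#) a) ⟩
        (1# + (a - 1#)) - b         ≡⟨ cong (_- b) (sym (+-assoc 1# a (- 1#))) ⟩
        ((1# + a) - 1#) - b         ≡⟨ +-assoc (1# + a) (- 1#) (- b) ⟩
        (1# + a) + (- 1# + - b)     ≡⟨ cong ((1# + a) +_) (-‿+-comm 1# b) ⟩
        (1# + a) - (1# + b)         ∎
        where
        open ≡-Reasoning
        a = m · 1#
        b = n · 1#

      +-homo : ∀ i j → ⟦ i ℤ.+ j ⟧ℤ ≡ ⟦ i ⟧ℤ + ⟦ j ⟧ℤ
      +-homo (ℤ.+ m) (ℤ.+ n) = ×-homo-+ 1# m n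
      +-homo (ℤ.+ m) -[1+ n ] = ⊖-homo m (suc n)
      +-homo -[1+ m ] (ℤ.+ n) = trans (⊖-homo n (suc m)) (+-comm _ _)
      +-homo -[1+ m ] -[1+ n ] = begin
        - (suc (suc (m ℕ.+ n)) · 1#)              ≡⟨ cong (λ k → - (suc k · 1#)) (sym (ℕ.+-suc m n)) ⟩
        - (1# + ((m ℕ.+ suc n) · 1#))             ≡⟨ cong (λ z → - (1# + z)) (×-homo-+ 1# m (suc n)) ⟩
        - (1# + ((m · 1#) + (suc n · 1#)))        ≡⟨ cong -_ (sym (+-assoc 1# _ _)) ⟩
        - ((1# + (m · 1#)) + (suc n · 1#))        ≡⟨ sym (-‿+-comm _ _) ⟩
        ⟦ -[1+ m ] ⟧ℤ + ⟦ -[1+ n ] ⟧ℤ              ∎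
        where open ≡-Reasoning

      neg-homo : ∀ i → ⟦ ℤ.- i ⟧ℤ ≡ - ⟦ i ⟧ℤ
      neg-homo (ℤ.+ zero) = sym -0#≈0#
      neg-homo (ℤ.+ suc n) = refl
      neg-homo -[1+ n ] = sym (-‿involutive _)

      ℤ-rawRing : RawRing 0ℓ 0ℓ
      ℤ-rawRing = record
        { Carrier = ℤ ; _≈_ = _≡_ ; _+_ = ℤ._+_ ; _*_ = ℤ._*_ ; -_ = ℤ.-_ ; 0# = ℤ.+ 0 ; 1# = ℤ.+ 1 }

      almostCommutativeRing : ACR.AlmostCommutativeRing 0ℓ 0ℓ
      almostCommutativeRing = ACR.fromCommutativeRing commutativeRing

      ℤ-homomorphism : ℤ-rawRing ACR.-Raw-AlmostCommutative⟶ almostCommutativeRing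
      ℤ-homomorphism = record
        { ⟦_⟧ = ⟦_⟧ℤ ; +-homo = +-homo ; *-homo = *-homo ; -‿homo = neg-homo
        ; 0-homo = refl ; 1-homo = +-identityʳ 1# }

      ⟦⟧ℤ-≟ : ∀ i j → Maybe (⟦ i ⟧ℤ ≡ ⟦ j ⟧ℤ)
      ⟦⟧ℤ-≟ i j with i ℤ.≟ j
      ... | yes refl = just refl
      ... | no _ = nothing

    open Algebra.Solver.Ring ℤ-rawRing almostCommutativeRing ℤ-homomorphism ⟦⟧ℤ-≟ public
      using (solve; _:+_; _:*_; :-_; _:-_; _:=_; con)

    nonneg? : ∀ x → Dec (NonNeg x)
    nonneg? x = T? (nonnegᵇ x)

    ¬nonneg⇒neg-nonneg : ∀ {x} → ¬ NonNeg x → NonNeg (- x)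
    ¬nonneg⇒neg-nonneg {x} ¬x≥0 with nonneg-total x
    ... | inj₁ x≥0 = ⊥-elim (¬x≥0 x≥0)
    ... | inj₂ -x≥0 = -x≥0

    0-nonneg : NonNeg 0#
    0-nonneg with nonneg-total 0#
    ... | inj₁ 0≥0 = 0≥0
    ... | inj₂ -0≥0 = subst NonNeg -0#≈0# -0≥0

    x-y≡0⇒x≡y : ∀ {x y} → x - y ≡ 0# → x ≡ y
    x-y≡0⇒x≡y {x} {y} x-y≡0 = begin
      x         ≡⟨ sym (-‿involutive x) ⟩
      - - x     ≡⟨ cong -_ (sym (+-inverseʳ-unique x (- y) x-y≡0)) ⟩
      - - y     ≡⟨ -‿involutive y ⟩
      y         ∎
      where open ≡-Reasoning

    square-nonneg : ∀ x → NonNeg (x * x)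
    square-nonneg x with nonneg? x
    ... | yes x≥0 = *-nonneg x≥0 x≥0
    ... | no ¬x≥0 = subst NonNeg (solve 1 (λ x → :- x :* :- x := x :* x) refl x)
                      (*-nonneg (¬nonneg⇒neg-nonneg ¬x≥0) (¬nonneg⇒neg-nonneg ¬x≥0))

    square≡0⇒≡0 : ∀ {x} → x * x ≡ 0# → x ≡ 0#
    square≡0⇒≡0 x²≡0 with noZeroDivisors x²≡0
    ... | inj₁ x≡0 = x≡0
    ... | inj₂ x≡0 = x≡0

    ≡0⇒nonneg : ∀ {x} → x ≡ 0# → NonNeg x
    ≡0⇒nonneg x≡0 = subst NonNeg (sym x≡0) 0-nonneg

    -- If y - x < 0 then (y - x)(y + x) ≤ 0 ≤ y² - x², so (y - x)(y + x) = 0.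
    square-cancel-≤ : ∀ {x y} → NonNeg x → NonNeg y → NonNeg (y * y - x * x) → NonNeg (y - x)
    square-cancel-≤ {x} {y} x≥0 y≥0 y²-x²≥0 = decidable-stable (nonneg? (y - x)) λ y-x<0 →
      y-x<0 (Sum.[ ≡0⇒nonneg , (λ y+x≡0 → ≡0⇒nonneg (y-x≡0 y+x≡0)) ]′ (noZeroDivisors (product≡0 y-x<0)))
      where
      product≡0 : ¬ NonNeg (y - x) → (y - x) * (y + x) ≡ 0#
      product≡0 y-x<0 = trans (solve 2 (λ x y → (y :- x) :* (y :+ x) := y :* y :- x :* x) refl x y)
        (nonneg-antisym y²-x²≥0
          (subst NonNeg (solve 2 (λ x y → :- (y :- x) :* (y :+ x) := :- (y :* y :- x :* x)) refl x y)
            (*-nonneg (¬nonneg⇒neg-nonneg y-x<0) (+-nonneg y≥0 x≥0))))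
      y-x≡0 : y + x ≡ 0# → y - x ≡ 0#
      y-x≡0 y+x≡0 = begin
        y - x       ≡⟨ cong (λ z → y - z) x≡-y ⟩
        y - - y     ≡⟨ cong (λ z → z - - z) y≡0 ⟩
        0# - - 0#   ≡⟨ solve 0 (con (ℤ.+ 0) :- :- con (ℤ.+ 0) := con (ℤ.+ 0)) refl ⟩
        0#          ∎
        where
        open ≡-Reasoning
        x≡-y = +-inverseʳ-unique y x y+x≡0
        y≡0 = nonneg-antisym y≥0 (subst NonNeg x≡-y x≥0)

  module QuadraticExtension (R : DecOrderedDomain) (d : DecOrderedDomain.Carrier R)
                            (d≥0 : T (DecOrderedDomain.nonnegᵇ R d)) where
    open DecOrderedDomainProperties R

    -- a + b √d ≥ 0, by the signs of a and b
    data NonNeg√ (a b : Carrier) : Set where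
      both-nonneg : NonNeg a → NonNeg b → NonNeg√ a b
      b-negative  : NonNeg a → ¬ NonNeg b → NonNeg (a * a - d * (b * b)) → NonNeg√ a b
      a-negative  : ¬ NonNeg a → NonNeg b → NonNeg (d * (b * b) - a * a) → NonNeg√ a b

    nonneg√-if-a≥0 : ∀ {a b} → NonNeg a → NonNeg (a * a - d * (b * b)) → NonNeg√ a b
    nonneg√-if-a≥0 {a} {b} a≥0 q with nonneg? b
    ... | yes b≥0 = both-nonneg a≥0 b≥0
    ... | no b<0 = b-negative a≥0 b<0 q

    nonneg√-if-b≥0 : ∀ {a b} → NonNeg b → NonNeg (d * (b * b) - a * a) → NonNeg√ a b
    nonneg√-if-b≥0 {a} {b} b≥0 q with nonneg? a
    ... | yes a≥0 = both-nonneg a≥0 b≥0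
    ... | no a<0 = a-negative a<0 b≥0 q

    private
      neg⇒ : ∀ {x} → ¬ NonNeg x → NonNeg (- x)
      neg⇒ = ¬nonneg⇒neg-nonneg

      both+b-negative : ∀ {a b c e} → NonNeg a → NonNeg b →
        NonNeg c → ¬ NonNeg e → NonNeg (c * c - d * (e * e)) → NonNeg√ (a + c) (b + e)
      both+b-negative {a} {b} {c} {e} a≥0 b≥0 c≥0 e<0 q with nonneg? (b + e)
      ... | yes b+e≥0 = both-nonneg (+-nonneg a≥0 c≥0) b+e≥0
      ... | no b+e<0 = b-negative (+-nonneg a≥0 c≥0) b+e<0
        (subst NonNeg
          (solve 5 (λ a b c e d → a :* (a :+ c :+ c) :+ (c :* c :- d :* (e :* e)) :+ d :* (b :* (:- (b :+ e) :+ :- e))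
                                := (a :+ c) :* (a :+ c) :- d :* ((b :+ e) :* (b :+ e))) refl a b c e d)
          (+-nonneg (+-nonneg (*-nonneg a≥0 (+-nonneg (+-nonneg a≥0 c≥0) c≥0)) q)
                    (*-nonneg d≥0 (*-nonneg b≥0 (+-nonneg (neg⇒ b+e<0) (neg⇒ e<0))))))

      both+a-negative : ∀ {a b c e} → NonNeg a → NonNeg b →
        ¬ NonNeg c → NonNeg e → NonNeg (d * (e * e) - c * c) → NonNeg√ (a + c) (b + e)
      both+a-negative {a} {b} {c} {e} a≥0 b≥0 c<0 e≥0 q with nonneg? (a + c)
      ... | yes a+c≥0 = both-nonneg a+c≥0 (+-nonneg b≥0 e≥0)
      ... | no a+c<0 = a-negative a+c<0 (+-nonneg b≥0 e≥0)
        (subst NonNeg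
          (solve 5 (λ a b c e d → d :* (b :* (b :+ e :+ e)) :+ (d :* (e :* e) :- c :* c) :+ a :* (:- (a :+ c) :+ :- c)
                                := d :* ((b :+ e) :* (b :+ e)) :- (a :+ c) :* (a :+ c)) refl a b c e d)
          (+-nonneg (+-nonneg (*-nonneg d≥0 (*-nonneg b≥0 (+-nonneg (+-nonneg b≥0 e≥0) e≥0))) q)
                    (*-nonneg a≥0 (+-nonneg (neg⇒ a+c<0) (neg⇒ c<0)))))

      -- the cross term ac - d(-b)(-e) is nonnegative because its square dominates
      b-negative+b-negative : ∀ {a b c e} →
        NonNeg a → ¬ NonNeg b → NonNeg (a * a - d * (b * b)) →
        NonNeg c → ¬ NonNeg e → NonNeg (c * c - d * (e * e)) → NonNeg√ (a + c) (b + e)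
      b-negative+b-negative {a} {b} {c} {e} a≥0 b<0 q₁ c≥0 e<0 q₂ with nonneg? (b + e)
      ... | yes b+e≥0 = both-nonneg (+-nonneg a≥0 c≥0) b+e≥0
      ... | no b+e<0 = b-negative (+-nonneg a≥0 c≥0) b+e<0
        (subst NonNeg
          (solve 5 (λ a b c e d → (a :* a :- d :* (b :* b)) :+ (c :* c :- d :* (e :* e))
                                  :+ (a :* c :- d :* (:- b :* :- e)) :+ (a :* c :- d :* (:- b :* :- e))
                                := (a :+ c) :* (a :+ c) :- d :* ((b :+ e) :* (b :+ e))) refl a b c e d)
          (+-nonneg (+-nonneg (+-nonneg q₁ q₂) cross≥0) cross≥0))
        where
        cross≥0 : NonNeg (a * c - d * (- b * - e))
        cross≥0 = square-cancel-≤ (*-nonneg d≥0 (*-nonneg (neg⇒ b<0) (neg⇒ e<0))) (*-nonneg a≥0 c≥0)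
          (subst NonNeg
            (solve 5 (λ a b c e d → (a :* a :- d :* (b :* b)) :* (c :* c) :+ (d :* (:- b :* :- b)) :* (c :* c :- d :* (e :* e))
                                  := (a :* c) :* (a :* c) :- (d :* (:- b :* :- e)) :* (d :* (:- b :* :- e))) refl a b c e d)
            (+-nonneg (*-nonneg q₁ (*-nonneg c≥0 c≥0)) (*-nonneg (*-nonneg d≥0 (*-nonneg (neg⇒ b<0) (neg⇒ b<0))) q₂)))

      a-negative+a-negative : ∀ {a b c e} →
        ¬ NonNeg a → NonNeg b → NonNeg (d * (b * b) - a * a) →
        ¬ NonNeg c → NonNeg e → NonNeg (d * (e * e) - c * c) → NonNeg√ (a + c) (b + e)
      a-negative+a-negative {a} {b} {c} {e} a<0 b≥0 q₁ c<0 e≥0 q₂ with nonneg? (a + c)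
      ... | yes a+c≥0 = both-nonneg a+c≥0 (+-nonneg b≥0 e≥0)
      ... | no a+c<0 = a-negative a+c<0 (+-nonneg b≥0 e≥0)
        (subst NonNeg
          (solve 5 (λ a b c e d → (d :* (b :* b) :- a :* a) :+ (d :* (e :* e) :- c :* c)
                                  :+ (d :* (b :* e) :- (:- a :* :- c)) :+ (d :* (b :* e) :- (:- a :* :- c))
                                := d :* ((b :+ e) :* (b :+ e)) :- (a :+ c) :* (a :+ c)) refl a b c e d)
          (+-nonneg (+-nonneg (+-nonneg q₁ q₂) cross≥0) cross≥0))
        where
        cross≥0 : NonNeg (d * (b * e) - (- a * - c))
        cross≥0 = square-cancel-≤ (*-nonneg (neg⇒ a<0) (neg⇒ c<0)) (*-nonneg d≥0 (*-nonneg b≥0 e≥0))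
          (subst NonNeg
            (solve 5 (λ a b c e d → (d :* (b :* b) :- a :* a) :* (d :* (e :* e)) :+ (:- a :* :- a) :* (d :* (e :* e) :- c :* c)
                                  := (d :* (b :* e)) :* (d :* (b :* e)) :- (:- a :* :- c) :* (:- a :* :- c)) refl a b c e d)
            (+-nonneg (*-nonneg q₁ (*-nonneg d≥0 (*-nonneg e≥0 e≥0))) (*-nonneg (*-nonneg (neg⇒ a<0) (neg⇒ a<0)) q₂)))

      -- If the norm of the sum were negative, the cross term -(a + c) c + d (b + e) e would be
      -- nonnegative by square-cancel-≤, and then the norm would be nonnegative after all.
      b-negative+a-negative-norm : ∀ {a b c e} → NonNeg (a * a - d * (b * b)) →
        ¬ NonNeg c → NonNeg e → NonNeg (d * (e * e) - c * c) → NonNeg (a + c) → ¬ NonNeg (b + e) →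
        NonNeg ((a + c) * (a + c) - d * ((b + e) * (b + e)))
      b-negative+a-negative-norm {a} {b} {c} {e} q₁ c<0 e≥0 q₂ a+c≥0 b+e<0 =
        decidable-stable (nonneg? _) λ N<0 → N<0 (subst NonNeg
          (solve 5 (λ a b c e d → (a :* a :- d :* (b :* b)) :+ (d :* (e :* e) :- c :* c)
                                  :+ (d :* (:- (b :+ e) :* e) :- (a :+ c) :* (:- c))
                                  :+ (d :* (:- (b :+ e) :* e) :- (a :+ c) :* (:- c))
                                := (a :+ c) :* (a :+ c) :- d :* ((b :+ e) :* (b :+ e))) refl a b c e d)
          (+-nonneg (+-nonneg (+-nonneg q₁ q₂) (cross≥0 N<0)) (cross≥0 N<0)))
        where
        cross≥0 : ¬ NonNeg ((a + c) * (a + c) - d * ((b + e) * (b + e))) → NonNeg (d * (- (b + e) * e) - (a + c) * (- c))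
        cross≥0 N<0 = square-cancel-≤ (*-nonneg a+c≥0 (neg⇒ c<0)) (*-nonneg d≥0 (*-nonneg (neg⇒ b+e<0) e≥0))
          (subst NonNeg
            (solve 5 (λ a b c e d → (:- ((a :+ c) :* (a :+ c) :- d :* ((b :+ e) :* (b :+ e)))) :* (d :* (e :* e))
                                    :+ ((a :+ c) :* (a :+ c)) :* (d :* (e :* e) :- c :* c)
                                  := (d :* (:- (b :+ e) :* e)) :* (d :* (:- (b :+ e) :* e))
                                     :- ((a :+ c) :* (:- c)) :* ((a :+ c) :* (:- c))) refl a b c e d)
            (+-nonneg (*-nonneg (neg⇒ N<0) (*-nonneg d≥0 (*-nonneg e≥0 e≥0))) (*-nonneg (*-nonneg a+c≥0 a+c≥0) q₂)))

      b-negative+a-negative-norm′ : ∀ {a b c e} → NonNeg a → ¬ NonNeg b → NonNeg (a * a - d * (b * b)) →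
        NonNeg (d * (e * e) - c * c) → ¬ NonNeg (a + c) → NonNeg (b + e) →
        NonNeg (d * ((b + e) * (b + e)) - (a + c) * (a + c))
      b-negative+a-negative-norm′ {a} {b} {c} {e} a≥0 b<0 q₁ q₂ a+c<0 b+e≥0 =
        decidable-stable (nonneg? _) λ N<0 → N<0 (subst NonNeg
          (solve 5 (λ a b c e d → (a :* a :- d :* (b :* b)) :+ (d :* (e :* e) :- c :* c)
                                  :+ ((:- (a :+ c)) :* a :- d :* ((b :+ e) :* (:- b)))
                                  :+ ((:- (a :+ c)) :* a :- d :* ((b :+ e) :* (:- b)))
                                := d :* ((b :+ e) :* (b :+ e)) :- (a :+ c) :* (a :+ c)) refl a b c e d)
          (+-nonneg (+-nonneg (+-nonneg q₁ q₂) (cross≥0 N<0)) (cross≥0 N<0)))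
        where
        cross≥0 : ¬ NonNeg (d * ((b + e) * (b + e)) - (a + c) * (a + c)) → NonNeg ((- (a + c)) * a - d * ((b + e) * (- b)))
        cross≥0 N<0 = square-cancel-≤ (*-nonneg d≥0 (*-nonneg b+e≥0 (neg⇒ b<0))) (*-nonneg (neg⇒ a+c<0) a≥0)
          (subst NonNeg
            (solve 5 (λ a b c e d → (:- (d :* ((b :+ e) :* (b :+ e)) :- (a :+ c) :* (a :+ c))) :* (a :* a)
                                    :+ (d :* ((b :+ e) :* (b :+ e))) :* (a :* a :- d :* (b :* b))
                                  := ((:- (a :+ c)) :* a) :* ((:- (a :+ c)) :* a)
                                     :- (d :* ((b :+ e) :* (:- b))) :* (d :* ((b :+ e) :* (:- b)))) refl a b c e d)
            (+-nonneg (*-nonneg (neg⇒ N<0) (*-nonneg a≥0 a≥0)) (*-nonneg (*-nonneg d≥0 (*-nonneg b+e≥0 b+e≥0)) q₁)))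

      b-negative+a-negative : ∀ {a b c e} →
        NonNeg a → ¬ NonNeg b → NonNeg (a * a - d * (b * b)) →
        ¬ NonNeg c → NonNeg e → NonNeg (d * (e * e) - c * c) → NonNeg√ (a + c) (b + e)
      b-negative+a-negative {a} {b} {c} {e} a≥0 b<0 q₁ c<0 e≥0 q₂ with nonneg? (a + c) | nonneg? (b + e)
      ... | yes a+c≥0 | yes b+e≥0 = both-nonneg a+c≥0 b+e≥0
      ... | yes a+c≥0 | no b+e<0 = b-negative a+c≥0 b+e<0 (b-negative+a-negative-norm q₁ c<0 e≥0 q₂ a+c≥0 b+e<0)
      ... | no a+c<0 | yes b+e≥0 = a-negative a+c<0 b+e≥0 (b-negative+a-negative-norm′ a≥0 b<0 q₁ q₂ a+c<0 b+e≥0)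
      ... | no a+c<0 | no b+e<0 = ⊥-elim (a+c<0 (subst NonNeg (solve 2 (λ a c → a :- (:- c) := a :+ c) refl a c)
        (square-cancel-≤ (neg⇒ c<0) a≥0
          (subst NonNeg
            (solve 5 (λ a b c e d → (a :* a :- d :* (b :* b)) :+ d :* ((:- (b :+ e)) :* (:- b :+ e)) :+ (d :* (e :* e) :- c :* c)
                                  := a :* a :- (:- c) :* (:- c)) refl a b c e d)
            (+-nonneg (+-nonneg q₁ (*-nonneg d≥0 (*-nonneg (neg⇒ b+e<0) (+-nonneg (neg⇒ b<0) e≥0)))) q₂)))))

      swap-summands : ∀ {a b c e} → NonNeg√ (c + a) (e + b) → NonNeg√ (a + c) (b + e)
      swap-summands {a} {b} {c} {e} = subst₂ NonNeg√ (+-comm c a) (+-comm e b)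

    +-nonneg√ : ∀ {a b c e} → NonNeg√ a b → NonNeg√ c e → NonNeg√ (a + c) (b + e)
    +-nonneg√ (both-nonneg a≥0 b≥0) (both-nonneg c≥0 e≥0) = both-nonneg (+-nonneg a≥0 c≥0) (+-nonneg b≥0 e≥0)
    +-nonneg√ (both-nonneg a≥0 b≥0) (b-negative c≥0 e<0 q) = both+b-negative a≥0 b≥0 c≥0 e<0 q
    +-nonneg√ (both-nonneg a≥0 b≥0) (a-negative c<0 e≥0 q) = both+a-negative a≥0 b≥0 c<0 e≥0 q
    +-nonneg√ (b-negative a≥0 b<0 q) (both-nonneg c≥0 e≥0) = swap-summands (both+b-negative c≥0 e≥0 a≥0 b<0 q)
    +-nonneg√ (b-negative a≥0 b<0 q₁) (b-negative c≥0 e<0 q₂) = b-negative+b-negative a≥0 b<0 q₁ c≥0 e<0 q₂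
    +-nonneg√ (b-negative a≥0 b<0 q₁) (a-negative c<0 e≥0 q₂) = b-negative+a-negative a≥0 b<0 q₁ c<0 e≥0 q₂
    +-nonneg√ (a-negative a<0 b≥0 q) (both-nonneg c≥0 e≥0) = swap-summands (both+a-negative c≥0 e≥0 a<0 b≥0 q)
    +-nonneg√ (a-negative a<0 b≥0 q₁) (b-negative c≥0 e<0 q₂) = swap-summands (b-negative+a-negative c≥0 e<0 q₂ a<0 b≥0 q₁)
    +-nonneg√ (a-negative a<0 b≥0 q₁) (a-negative c<0 e≥0 q₂) = a-negative+a-negative a<0 b≥0 q₁ c<0 e≥0 q₂

    scale-nonneg√ : ∀ {a b c} → NonNeg c → NonNeg√ a b → NonNeg√ (c * a) (c * b)
    scale-nonneg√ c≥0 (both-nonneg a≥0 b≥0) = both-nonneg (*-nonneg c≥0 a≥0) (*-nonneg c≥0 b≥0)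
    scale-nonneg√ {a} {b} {c} c≥0 (b-negative a≥0 _ q) = nonneg√-if-a≥0 (*-nonneg c≥0 a≥0)
      (subst NonNeg (solve 4 (λ a b c d → (c :* c) :* (a :* a :- d :* (b :* b))
                                        := (c :* a) :* (c :* a) :- d :* ((c :* b) :* (c :* b))) refl a b c d)
        (*-nonneg (*-nonneg c≥0 c≥0) q))
    scale-nonneg√ {a} {b} {c} c≥0 (a-negative _ b≥0 q) = nonneg√-if-b≥0 (*-nonneg c≥0 b≥0)
      (subst NonNeg (solve 4 (λ a b c d → (c :* c) :* (d :* (b :* b) :- a :* a)
                                        := d :* ((c :* b) :* (c :* b)) :- (c :* a) :* (c :* a)) refl a b c d)
        (*-nonneg (*-nonneg c≥0 c≥0) q))

    √d*-nonneg√ : ∀ {a b} → NonNeg√ a b → NonNeg√ (d * b) a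
    √d*-nonneg√ (both-nonneg a≥0 b≥0) = both-nonneg (*-nonneg d≥0 b≥0) a≥0
    √d*-nonneg√ {a} {b} (b-negative a≥0 _ q) = nonneg√-if-b≥0 a≥0
      (subst NonNeg (solve 3 (λ a b d → d :* (a :* a :- d :* (b :* b)) := d :* (a :* a) :- (d :* b) :* (d :* b)) refl a b d)
        (*-nonneg d≥0 q))
    √d*-nonneg√ {a} {b} (a-negative a<0 b≥0 q) = b-negative (*-nonneg d≥0 b≥0) a<0
      (subst NonNeg (solve 3 (λ a b d → d :* (d :* (b :* b) :- a :* a) := (d :* b) :* (d :* b) :- d :* (a :* a)) refl a b d)
        (*-nonneg d≥0 q))

    private
      -- (a + b√d)(c + e√d) = c (a + b√d) + e √d (a + b√d)
      *-nonneg√-by-nonneg : ∀ {a b c e} → NonNeg c → NonNeg e → NonNeg√ a b →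
                            NonNeg√ (a * c + d * (b * e)) (a * e + b * c)
      *-nonneg√-by-nonneg {a} {b} {c} {e} c≥0 e≥0 ab≥0 =
        subst₂ NonNeg√ (solve 5 (λ a b c e d → c :* a :+ e :* (d :* b) := a :* c :+ d :* (b :* e)) refl a b c e d)
                       (solve 4 (λ a b c e → c :* b :+ e :* a := a :* e :+ b :* c) refl a b c e)
          (+-nonneg√ (scale-nonneg√ c≥0 ab≥0) (scale-nonneg√ e≥0 (√d*-nonneg√ ab≥0)))

      nonneg-by-*-nonneg√ : ∀ {a b c e} → NonNeg a → NonNeg b → NonNeg√ c e →
                            NonNeg√ (a * c + d * (b * e)) (a * e + b * c)
      nonneg-by-*-nonneg√ {a} {b} {c} {e} a≥0 b≥0 ce≥0 =
        subst₂ NonNeg√ (solve 5 (λ a b c e d → c :* a :+ d :* (e :* b) := a :* c :+ d :* (b :* e)) refl a b c e d)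
                       (solve 4 (λ a b c e → c :* b :+ e :* a := a :* e :+ b :* c) refl a b c e)
          (*-nonneg√-by-nonneg a≥0 b≥0 ce≥0)

      P Q : Carrier → Carrier → Carrier → Carrier → Carrier
      P a b c e = a * c + d * (b * e)
      Q a b c e = a * e + b * c

      norm-* : ∀ a b c e → (a * a - d * (b * b)) * (c * c - d * (e * e)) ≡ P a b c e * P a b c e - d * (Q a b c e * Q a b c e)
      norm-* a b c e = solve 5 (λ a b c e d → (a :* a :- d :* (b :* b)) :* (c :* c :- d :* (e :* e))
        := (a :* c :+ d :* (b :* e)) :* (a :* c :+ d :* (b :* e)) :- d :* ((a :* e :+ b :* c) :* (a :* e :+ b :* c))) refl a b c e d

      norm-*-aa : ∀ a b c e → (d * (b * b) - a * a) * (d * (e * e) - c * c) ≡ P a b c e * P a b c e - d * (Q a b c e * Q a b c e)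
      norm-*-aa a b c e = solve 5 (λ a b c e d → (d :* (b :* b) :- a :* a) :* (d :* (e :* e) :- c :* c)
        := (a :* c :+ d :* (b :* e)) :* (a :* c :+ d :* (b :* e)) :- d :* ((a :* e :+ b :* c) :* (a :* e :+ b :* c))) refl a b c e d

      norm-*-ba : ∀ a b c e → (a * a - d * (b * b)) * (d * (e * e) - c * c) ≡ d * (Q a b c e * Q a b c e) - P a b c e * P a b c e
      norm-*-ba a b c e = solve 5 (λ a b c e d → (a :* a :- d :* (b :* b)) :* (d :* (e :* e) :- c :* c)
        := d :* ((a :* e :+ b :* c) :* (a :* e :+ b :* c)) :- (a :* c :+ d :* (b :* e)) :* (a :* c :+ d :* (b :* e))) refl a b c e d

      norm-*-ab : ∀ a b c e → (d * (b * b) - a * a) * (c * c - d * (e * e)) ≡ d * (Q a b c e * Q a b c e) - P a b c e * P a b c e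
      norm-*-ab a b c e = solve 5 (λ a b c e d → (d :* (b :* b) :- a :* a) :* (c :* c :- d :* (e :* e))
        := d :* ((a :* e :+ b :* c) :* (a :* e :+ b :* c)) :- (a :* c :+ d :* (b :* e)) :* (a :* c :+ d :* (b :* e))) refl a b c e d

      neg*neg : ∀ x y → - x * - y ≡ x * y
      neg*neg = solve 2 (λ x y → :- x :* :- y := x :* y) refl

    *-nonneg√ : ∀ {a b c e} → NonNeg√ a b → NonNeg√ c e → NonNeg√ (a * c + d * (b * e)) (a * e + b * c)
    *-nonneg√ ab≥0 (both-nonneg c≥0 e≥0) = *-nonneg√-by-nonneg c≥0 e≥0 ab≥0
    *-nonneg√ (both-nonneg a≥0 b≥0) ce≥0 = nonneg-by-*-nonneg√ a≥0 b≥0 ce≥0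
    *-nonneg√ {a} {b} {c} {e} (b-negative a≥0 b<0 q₁) (b-negative c≥0 e<0 q₂) =
      nonneg√-if-a≥0 (+-nonneg (*-nonneg a≥0 c≥0) (subst NonNeg (cong (d *_) (neg*neg b e)) (*-nonneg d≥0 (*-nonneg (neg⇒ b<0) (neg⇒ e<0)))))
                     (subst NonNeg (norm-* a b c e) (*-nonneg q₁ q₂))
    *-nonneg√ {a} {b} {c} {e} (a-negative a<0 b≥0 q₁) (a-negative c<0 e≥0 q₂) =
      nonneg√-if-a≥0 (+-nonneg (subst NonNeg (neg*neg a c) (*-nonneg (neg⇒ a<0) (neg⇒ c<0))) (*-nonneg d≥0 (*-nonneg b≥0 e≥0)))
                     (subst NonNeg (norm-*-aa a b c e) (*-nonneg q₁ q₂))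
    *-nonneg√ {a} {b} {c} {e} (b-negative a≥0 b<0 q₁) (a-negative c<0 e≥0 q₂) =
      nonneg√-if-b≥0 (+-nonneg (*-nonneg a≥0 e≥0) (subst NonNeg (neg*neg b c) (*-nonneg (neg⇒ b<0) (neg⇒ c<0))))
                     (subst NonNeg (norm-*-ba a b c e) (*-nonneg q₁ q₂))
    *-nonneg√ {a} {b} {c} {e} (a-negative a<0 b≥0 q₁) (b-negative c≥0 e<0 q₂) =
      nonneg√-if-b≥0 (+-nonneg (subst NonNeg (neg*neg a e) (*-nonneg (neg⇒ a<0) (neg⇒ e<0))) (*-nonneg b≥0 c≥0))
                     (subst NonNeg (norm-*-ab a b c e) (*-nonneg q₁ q₂))

    nonneg√-total : ∀ a b → NonNeg√ a b ⊎ NonNeg√ (- a) (- b)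
    nonneg√-total a b with nonneg? a | nonneg? b
    ... | yes a≥0 | yes b≥0 = inj₁ (both-nonneg a≥0 b≥0)
    ... | no a<0  | no b<0  = inj₂ (both-nonneg (neg⇒ a<0) (neg⇒ b<0))
    ... | yes a≥0 | no b<0 with nonneg? (a * a - d * (b * b))
    ...   | yes q = inj₁ (b-negative a≥0 b<0 q)
    ...   | no ¬q = inj₂ (nonneg√-if-b≥0 (neg⇒ b<0)
      (subst NonNeg (solve 3 (λ a b d → :- (a :* a :- d :* (b :* b)) := d :* (:- b :* :- b) :- :- a :* :- a) refl a b d) (neg⇒ ¬q)))
    nonneg√-total a b | no a<0 | yes b≥0 with nonneg? (d * (b * b) - a * a)
    ...   | yes q = inj₁ (a-negative a<0 b≥0 q)
    ...   | no ¬q = inj₂ (nonneg√-if-a≥0 (neg⇒ a<0)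
      (subst NonNeg (solve 3 (λ a b d → :- (d :* (b :* b) :- a :* a) := :- a :* :- a :- d :* (:- b :* :- b)) refl a b d) (neg⇒ ¬q)))

    NonSquare : Set
    NonSquare = ∀ a b → a * a ≡ d * (b * b) → b ≡ 0#

    module _ (d-nonSquare : NonSquare) where

      norm≡0⇒≡0 : ∀ {a b} → a * a - d * (b * b) ≡ 0# → a ≡ 0# × b ≡ 0#
      norm≡0⇒≡0 {a} {b} N≡0 = square≡0⇒≡0 a²≡0 , b≡0
        where
        b≡0 = d-nonSquare a b (x-y≡0⇒x≡y N≡0)
        a²≡0 : a * a ≡ 0#
        a²≡0 = begin
          a * a            ≡⟨ x-y≡0⇒x≡y N≡0 ⟩
          d * (b * b)      ≡⟨ cong (λ z → d * (z * z)) b≡0 ⟩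
          d * (0# * 0#)    ≡⟨ solve 1 (λ d → d :* (con (ℤ.+ 0) :* con (ℤ.+ 0)) := con (ℤ.+ 0)) refl d ⟩
          0#               ∎
          where open ≡-Reasoning

      private
        norm-antisym : ∀ {a b} → NonNeg (a * a - d * (b * b)) → NonNeg (d * (b * b) - a * a) → b ≡ 0#
        norm-antisym {a} {b} q₁ q₂ = proj₂ (norm≡0⇒≡0 (nonneg-antisym q₁
          (subst NonNeg (solve 3 (λ a b d → d :* (b :* b) :- a :* a := :- (a :* a :- d :* (b :* b))) refl a b d) q₂)))

        nonneg√-a≡0 : ∀ {a b} → a ≡ 0# → NonNeg√ a b → NonNeg b
        nonneg√-a≡0 a≡0 (both-nonneg _ b≥0) = b≥0
        nonneg√-a≡0 a≡0 (a-negative a<0 _ _) = ⊥-elim (a<0 (≡0⇒nonneg a≡0))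
        nonneg√-a≡0 {a} {b} a≡0 (b-negative _ _ q) = ≡0⇒nonneg b≡0
          where
          -db²≥0 : NonNeg (- (d * (b * b)))
          -db²≥0 = subst NonNeg (trans (cong (λ z → z * z - d * (b * b)) a≡0)
                     (solve 2 (λ b d → con (ℤ.+ 0) :* con (ℤ.+ 0) :- d :* (b :* b) := :- (d :* (b :* b))) refl b d)) q
          b≡0 = d-nonSquare 0# b (trans (zeroˡ 0#) (sym (nonneg-antisym (*-nonneg d≥0 (square-nonneg b)) -db²≥0)))

        nonneg√-b≡0 : ∀ {a b} → b ≡ 0# → NonNeg√ a b → NonNeg a
        nonneg√-b≡0 b≡0 (both-nonneg a≥0 _) = a≥0
        nonneg√-b≡0 b≡0 (b-negative a≥0 _ _) = a≥0
        nonneg√-b≡0 {a} {b} b≡0 (a-negative _ _ q) = ≡0⇒nonneg a≡0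
          where
          -a²≥0 : NonNeg (- (a * a))
          -a²≥0 = subst NonNeg (trans (cong (λ z → d * (z * z) - a * a) b≡0)
                    (solve 2 (λ a d → d :* (con (ℤ.+ 0) :* con (ℤ.+ 0)) :- a :* a := :- (a :* a)) refl a d)) q
          a≡0 = square≡0⇒≡0 (nonneg-antisym (square-nonneg a) -a²≥0)

        ¬both-negative : ∀ {x} → ¬ NonNeg x → ¬ NonNeg (- x) → ⊥
        ¬both-negative x<0 -x<0 = -x<0 (neg⇒ x<0)

        neg≡0 : ∀ {x} → x ≡ 0# → - x ≡ 0#
        neg≡0 x≡0 = trans (cong -_ x≡0) -0#≈0#

        square-neg : ∀ x y → - x * - x - d * (- y * - y) ≡ x * x - d * (y * y)
        square-neg x y = solve 3 (λ x y d → :- x :* :- x :- d :* (:- y :* :- y) := x :* x :- d :* (y :* y)) refl x y d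

        square-neg′ : ∀ x y → d * (- y * - y) - - x * - x ≡ d * (y * y) - x * x
        square-neg′ x y = solve 3 (λ x y d → d :* (:- y :* :- y) :- :- x :* :- x := d :* (y :* y) :- x :* x) refl x y d

      nonneg√-antisym : ∀ {a b} → NonNeg√ a b → NonNeg√ (- a) (- b) → a ≡ 0# × b ≡ 0#
      nonneg√-antisym p q = go p q
        where
        via-a : ∀ {a b} → NonNeg√ a b → NonNeg√ (- a) (- b) → a ≡ 0# → a ≡ 0# × b ≡ 0#
        via-a p q a≡0 = a≡0 , nonneg-antisym (nonneg√-a≡0 a≡0 p) (nonneg√-a≡0 (neg≡0 a≡0) q)
        via-b : ∀ {a b} → NonNeg√ a b → NonNeg√ (- a) (- b) → b ≡ 0# → a ≡ 0# × b ≡ 0#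
        via-b p q b≡0 = nonneg-antisym (nonneg√-b≡0 b≡0 p) (nonneg√-b≡0 (neg≡0 b≡0) q) , b≡0
        go : ∀ {a b} → NonNeg√ a b → NonNeg√ (- a) (- b) → a ≡ 0# × b ≡ 0#
        go p@(both-nonneg a≥0 _) q@(both-nonneg -a≥0 _) = via-a p q (nonneg-antisym a≥0 -a≥0)
        go p@(both-nonneg a≥0 _) q@(b-negative -a≥0 _ _) = via-a p q (nonneg-antisym a≥0 -a≥0)
        go p@(both-nonneg _ b≥0) q@(a-negative _ -b≥0 _) = via-b p q (nonneg-antisym b≥0 -b≥0)
        go p@(b-negative a≥0 _ _) q@(both-nonneg -a≥0 _) = via-a p q (nonneg-antisym a≥0 -a≥0)
        go (b-negative _ b<0 _) (b-negative _ -b<0 _) = ⊥-elim (¬both-negative b<0 -b<0)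
        go {a} {b} (b-negative _ b<0 q₁) (a-negative _ _ q₂) =
          ⊥-elim (b<0 (≡0⇒nonneg (norm-antisym q₁ (subst NonNeg (square-neg′ a b) q₂))))
        go p@(a-negative _ b≥0 _) q@(both-nonneg _ -b≥0) = via-b p q (nonneg-antisym b≥0 -b≥0)
        go {a} {b} (a-negative _ b≥0 q₁) (b-negative _ -b<0 q₂) =
          ⊥-elim (-b<0 (≡0⇒nonneg (neg≡0 (norm-antisym (subst NonNeg (square-neg a b) q₂) q₁))))
        go (a-negative a<0 _ _) (a-negative -a<0 _ _) = ⊥-elim (¬both-negative a<0 -a<0)

      noZeroDivisors√ : ∀ {a b c e} → a * c + d * (b * e) ≡ 0# → a * e + b * c ≡ 0# →
                        (a ≡ 0# × b ≡ 0#) ⊎ (c ≡ 0# × e ≡ 0#)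
      noZeroDivisors√ {a} {b} {c} {e} P≡0 Q≡0 = Sum.map norm≡0⇒≡0 norm≡0⇒≡0 (noZeroDivisors normProduct≡0)
        where
        normProduct≡0 : (a * a - d * (b * b)) * (c * c - d * (e * e)) ≡ 0#
        normProduct≡0 = begin
          (a * a - d * (b * b)) * (c * c - d * (e * e))     ≡⟨ norm-* a b c e ⟩
          P a b c e * P a b c e - d * (Q a b c e * Q a b c e) ≡⟨ cong₂ (λ u v → u * u - d * (v * v)) P≡0 Q≡0 ⟩
          0# * 0# - d * (0# * 0#)                           ≡⟨ solve 1 (λ d → con (ℤ.+ 0) :* con (ℤ.+ 0) :- d :* (con (ℤ.+ 0) :* con (ℤ.+ 0)) := con (ℤ.+ 0)) refl d ⟩
          0#                                                ∎
          where open ≡-Reasoning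

module RealQuadratic where

  open import Data.Bool using (true; false; T)
  open import Data.Empty using (⊥-elim)
  open import Data.Integer as ℤ using (ℤ)
  import Data.Integer.Properties as ℤ
  open import Data.Nat as ℕ using (ℕ; zero; suc; _<_)
  import Data.Nat.Properties as ℕ
  open import Data.Nat.Divisibility using (divides)
  open import Data.Nat.Induction using (<-rec)
  open import Data.Nat.Primality using (euclidsLemma; prime[2])
  open import Data.Nat.Solver using (module +-*-Solver)
  open import Data.Product using (∃; _,_; uncurry)
  open import Data.Rational as ℚ using (ℚ; mkℚ; 0ℚ; 1ℚ; _≤ᵇ_)
  import Data.Rational.Properties as ℚ
  import Data.Rational.Unnormalised as ℚᵘ
  import Data.Rational.Unnormalised.Properties as ℚᵘ
  open import Data.Sum as Sum using (_⊎_; inj₁; inj₂)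
  open import Data.Unit using (tt)
  open import Relation.Binary.PropositionalEquality
  open import Relation.Nullary using (¬_; yes; no)
  open import Algebra.Structures using (IsCommutativeRing)

  open OrderedDomains

  m²≡2n²⇒n≡0 : ∀ m n → m ℕ.* m ≡ 2 ℕ.* (n ℕ.* n) → n ≡ 0
  m²≡2n²⇒n≡0 = <-rec _ descent
    where
    open +-*-Solver

    half-of-even-square : ∀ m k → m ℕ.* m ≡ 2 ℕ.* k → ∃ λ m′ → m ≡ m′ ℕ.* 2
    half-of-even-square m k eq with euclidsLemma m m prime[2] (divides k (trans eq (ℕ.*-comm 2 k)))
    ... | inj₁ (divides m′ m≡m′*2) = m′ , m≡m′*2
    ... | inj₂ (divides m′ m≡m′*2) = m′ , m≡m′*2

    halve : ∀ m n m′ → m ≡ m′ ℕ.* 2 → m ℕ.* m ≡ 2 ℕ.* (n ℕ.* n) → n ℕ.* n ≡ 2 ℕ.* (m′ ℕ.* m′)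
    halve m n m′ refl eq = ℕ.*-cancelˡ-≡ _ _ 2
      (trans (sym eq) (solve 1 (λ x → (x :* con 2) :* (x :* con 2) := con 2 :* (con 2 :* (x :* x))) refl m′))

    -- m = 2m′, then n = 2n′ with m′² = 2n′² and m′ < m
    descent : ∀ m → (∀ {m′} → m′ < m → ∀ n → m′ ℕ.* m′ ≡ 2 ℕ.* (n ℕ.* n) → n ≡ 0) →
              ∀ n → m ℕ.* m ≡ 2 ℕ.* (n ℕ.* n) → n ≡ 0
    descent zero _ zero _ = refl
    descent (suc m) rec n eq with half-of-even-square (suc m) (n ℕ.* n) eq
    ... | zero , ()
    ... | suc m′ , m≡m′*2 with half-of-even-square n (suc m′ ℕ.* suc m′) (halve (suc m) n (suc m′) m≡m′*2 eq)
    ...   | n′ , n≡n′*2 = trans n≡n′*2 (cong (ℕ._* 2) n′≡0)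
      where
      m′<m : suc m′ < suc m
      m′<m = subst (suc m′ <_) (sym m≡m′*2) (ℕ.m<m*n (suc m′) 2 (ℕ.s≤s (ℕ.s≤s ℕ.z≤n)))
      n′≡0 = rec m′<m n′ (halve n (suc m′) n′ n≡n′*2 (halve (suc m) n (suc m′) m≡m′*2 eq))

  private
    ℚ-+-nonneg : ∀ {p q} → T (0ℚ ≤ᵇ p) → T (0ℚ ≤ᵇ q) → T (0ℚ ≤ᵇ p ℚ.+ q)
    ℚ-+-nonneg {p} {q} p≥0 q≥0 = ℚ.≤⇒≤ᵇ (subst (ℚ._≤ p ℚ.+ q) (ℚ.+-identityˡ 0ℚ)
      (ℚ.+-mono-≤ (ℚ.≤ᵇ⇒≤ {0ℚ} {p} p≥0) (ℚ.≤ᵇ⇒≤ {0ℚ} {q} q≥0)))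

    ℚ-*-nonneg : ∀ {p q} → T (0ℚ ≤ᵇ p) → T (0ℚ ≤ᵇ q) → T (0ℚ ≤ᵇ p ℚ.* q)
    ℚ-*-nonneg {p} {q} p≥0 q≥0 = ℚ.≤⇒≤ᵇ (ℚ.nonNegative⁻¹ (p ℚ.* q)
      {{ℚ.nonNeg*nonNeg⇒nonNeg p {{ℚ.nonNegative (ℚ.≤ᵇ⇒≤ {0ℚ} {p} p≥0)}} q {{ℚ.nonNegative (ℚ.≤ᵇ⇒≤ {0ℚ} {q} q≥0)}}}})

    ℚ-nonneg-total : ∀ p → T (0ℚ ≤ᵇ p) ⊎ T (0ℚ ≤ᵇ ℚ.- p)
    ℚ-nonneg-total p with ℚ.≤-total 0ℚ p
    ... | inj₁ 0≤p = inj₁ (ℚ.≤⇒≤ᵇ 0≤p)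
    ... | inj₂ p≤0 = inj₂ (ℚ.≤⇒≤ᵇ (ℚ.neg-antimono-≤ p≤0))

    ℚ-nonneg-antisym : ∀ {p} → T (0ℚ ≤ᵇ p) → T (0ℚ ≤ᵇ ℚ.- p) → p ≡ 0ℚ
    ℚ-nonneg-antisym {p} p≥0 -p≥0 = ℚ.≤-antisym
      (subst₂ ℚ._≤_ (ℚ.+-identityʳ p) (ℚ.+-inverseʳ p) (ℚ.+-monoʳ-≤ p (ℚ.≤ᵇ⇒≤ {0ℚ} {ℚ.- p} -p≥0)))
      (ℚ.≤ᵇ⇒≤ {0ℚ} {p} p≥0)

    ℚ-noZeroDivisors : ∀ {p q} → p ℚ.* q ≡ 0ℚ → p ≡ 0ℚ ⊎ q ≡ 0ℚ
    ℚ-noZeroDivisors {p} {q} pq≡0 with p ℚ.≟ 0ℚ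
    ... | yes p≡0 = inj₁ p≡0
    ... | no p≢0 = inj₂ (begin
      q                     ≡⟨ sym (ℚ.*-identityˡ q) ⟩
      1ℚ ℚ.* q              ≡⟨ cong (ℚ._* q) (sym (ℚ.*-inverseˡ p)) ⟩
      (ℚ.1/ p ℚ.* p) ℚ.* q  ≡⟨ ℚ.*-assoc (ℚ.1/ p) p q ⟩
      ℚ.1/ p ℚ.* (p ℚ.* q)  ≡⟨ cong (ℚ.1/ p ℚ.*_) pq≡0 ⟩
      ℚ.1/ p ℚ.* 0ℚ         ≡⟨ ℚ.*-zeroʳ (ℚ.1/ p) ⟩
      0ℚ                    ∎)
      where
      open ≡-Reasoning
      instance _ = ℚ.≢-nonZero p≢0

  ℚ-decOrderedDomain : DecOrderedDomain
  ℚ-decOrderedDomain = record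
    { Carrier = ℚ ; _+_ = ℚ._+_ ; _*_ = ℚ._*_ ; -_ = ℚ.-_ ; 0# = 0ℚ ; 1# = 1ℚ
    ; isCommutativeRing = ℚ.+-*-isCommutativeRing
    ; nonnegᵇ = 0ℚ ≤ᵇ_
    ; +-nonneg = λ {p} {q} → ℚ-+-nonneg {p} {q}
    ; *-nonneg = λ {p} {q} → ℚ-*-nonneg {p} {q}
    ; nonneg-total = ℚ-nonneg-total
    ; nonneg-antisym = λ {p} → ℚ-nonneg-antisym {p}
    ; noZeroDivisors = ℚ-noZeroDivisors
    }

  two : ℚ
  two = ℤ.+ 2 ℚ./ 1

  -- Clearing denominators of (p/q)² = 2 (r/s)² gives (|p| s)² = 2 (|r| q)² in ℕ.
  √2-irrational : ∀ a b → a ℚ.* a ≡ two ℚ.* (b ℚ.* b) → b ≡ 0ℚ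
  √2-irrational a@(mkℚ p q-1 _) b@(mkℚ r s-1 _) a²≡2b² =
    ℚ.↥p≡0⇒p≡0 b (ℤ.∣i∣≡0⇒i≡0 (ℕ.m*n≡0⇒m≡0 R Q (m²≡2n²⇒n≡0 (P ℕ.* S) (R ℕ.* Q) inℕ)))
    where
    open +-*-Solver
    P = ℤ.∣ p ∣
    R = ℤ.∣ r ∣
    Q = suc q-1
    S = suc s-1
    inℚᵘ : ℚ.toℚᵘ a ℚᵘ.* ℚ.toℚᵘ a ℚᵘ.≃ ℚ.toℚᵘ two ℚᵘ.* (ℚ.toℚᵘ b ℚᵘ.* ℚ.toℚᵘ b)
    inℚᵘ = ℚᵘ.≃-trans (ℚᵘ.≃-sym (ℚ.toℚᵘ-homo-* a a)) (ℚᵘ.≃-trans (ℚ.toℚᵘ-cong a²≡2b²)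
             (ℚᵘ.≃-trans (ℚ.toℚᵘ-homo-* two (b ℚ.* b)) (ℚᵘ.*-congˡ {ℚ.toℚᵘ two} (ℚ.toℚᵘ-homo-* b b))))
    inℤ : (p ℤ.* p) ℤ.* ℤ.+ (1 ℕ.* (S ℕ.* S)) ≡ (ℤ.+ 2 ℤ.* (r ℤ.* r)) ℤ.* ℤ.+ (Q ℕ.* Q)
    inℤ = ℚᵘ.drop-*≡* inℚᵘ
    |inℤ| : (P ℕ.* P) ℕ.* (1 ℕ.* (S ℕ.* S)) ≡ (2 ℕ.* (R ℕ.* R)) ℕ.* (Q ℕ.* Q)
    |inℤ| = begin
      (P ℕ.* P) ℕ.* (1 ℕ.* (S ℕ.* S))          ≡⟨ cong (ℕ._* (1 ℕ.* (S ℕ.* S))) (sym (ℤ.abs-* p p)) ⟩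
      ℤ.∣ p ℤ.* p ∣ ℕ.* (1 ℕ.* (S ℕ.* S))      ≡⟨ sym (ℤ.abs-* (p ℤ.* p) _) ⟩
      ℤ.∣ (p ℤ.* p) ℤ.* ℤ.+ (1 ℕ.* (S ℕ.* S)) ∣ ≡⟨ cong ℤ.∣_∣ inℤ ⟩
      ℤ.∣ (ℤ.+ 2 ℤ.* (r ℤ.* r)) ℤ.* ℤ.+ (Q ℕ.* Q) ∣ ≡⟨ ℤ.abs-* (ℤ.+ 2 ℤ.* (r ℤ.* r)) _ ⟩
      ℤ.∣ ℤ.+ 2 ℤ.* (r ℤ.* r) ∣ ℕ.* (Q ℕ.* Q)  ≡⟨ cong (ℕ._* (Q ℕ.* Q)) (ℤ.abs-* (ℤ.+ 2) (r ℤ.* r)) ⟩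
      (2 ℕ.* ℤ.∣ r ℤ.* r ∣) ℕ.* (Q ℕ.* Q)      ≡⟨ cong (λ z → (2 ℕ.* z) ℕ.* (Q ℕ.* Q)) (ℤ.abs-* r r) ⟩
      (2 ℕ.* (R ℕ.* R)) ℕ.* (Q ℕ.* Q)          ∎
      where open ≡-Reasoning
    inℕ : (P ℕ.* S) ℕ.* (P ℕ.* S) ≡ 2 ℕ.* ((R ℕ.* Q) ℕ.* (R ℕ.* Q))
    inℕ = trans (solve 2 (λ P S → (P :* S) :* (P :* S) := (P :* P) :* (con 1 :* (S :* S))) refl P S)
            (trans |inℤ| (solve 2 (λ R Q → (con 2 :* (R :* R)) :* (Q :* Q) := con 2 :* ((R :* Q) :* (R :* Q))) refl R Q))

  module ℚ√2 = QuadraticExtension ℚ-decOrderedDomain two tt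

  private
    module ℚ-props = DecOrderedDomainProperties ℚ-decOrderedDomain
    open ℚ-props using (solve; _:+_; _:*_; :-_; _:-_; _:=_; con)

    ≤ᵇ⇒0≤ᵇ- : ∀ p q → T (p ≤ᵇ q) → T (0ℚ ≤ᵇ q ℚ.- p)
    ≤ᵇ⇒0≤ᵇ- p q p≤q = ℚ.≤⇒≤ᵇ (subst (ℚ._≤ q ℚ.- p) (ℚ.+-inverseʳ p) (ℚ.+-monoˡ-≤ (ℚ.- p) (ℚ.≤ᵇ⇒≤ {p} {q} p≤q)))

    0≤ᵇ-⇒≤ᵇ : ∀ p q → T (0ℚ ≤ᵇ q ℚ.- p) → T (p ≤ᵇ q)
    0≤ᵇ-⇒≤ᵇ p q 0≤q-p = ℚ.≤⇒≤ᵇ (subst₂ ℚ._≤_ (ℚ.+-identityˡ p) (solve 2 (λ p q → (q :- p) :+ p := q) refl p q)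
                                    (ℚ.+-monoˡ-≤ p (ℚ.≤ᵇ⇒≤ {0ℚ} {q ℚ.- p} 0≤q-p)))

    two*b*b : ∀ b → two ℚ.* b ℚ.* b ≡ two ℚ.* (b ℚ.* b)
    two*b*b b = ℚ.*-assoc two b b

  ≡true⇒T : ∀ {x} → x ≡ true → T x
  ≡true⇒T refl = tt

  ≡false⇒¬T : ∀ {x} → x ≡ false → ¬ T x
  ≡false⇒¬T refl ()

  nonneg₂⇒nonneg√ : ∀ a b → T (nonneg₂ (q2 a b)) → ℚ√2.NonNeg√ a b
  nonneg₂⇒nonneg√ a b h with 0ℚ ≤ᵇ a in a≥0 | 0ℚ ≤ᵇ b in b≥0
  ... | true | true = ℚ√2.both-nonneg (≡true⇒T a≥0) (≡true⇒T b≥0)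
  ... | true | false = ℚ√2.b-negative (≡true⇒T a≥0) (≡false⇒¬T b≥0)
    (subst (λ z → T (0ℚ ≤ᵇ a ℚ.* a ℚ.- z)) (two*b*b b) (≤ᵇ⇒0≤ᵇ- (two ℚ.* b ℚ.* b) (a ℚ.* a) h))
  ... | false | true = ℚ√2.a-negative (≡false⇒¬T a≥0) (≡true⇒T b≥0)
    (subst (λ z → T (0ℚ ≤ᵇ z ℚ.- a ℚ.* a)) (two*b*b b) (≤ᵇ⇒0≤ᵇ- (a ℚ.* a) (two ℚ.* b ℚ.* b) h))

  nonneg√⇒nonneg₂ : ∀ a b → ℚ√2.NonNeg√ a b → T (nonneg₂ (q2 a b))
  nonneg√⇒nonneg₂ a b h with 0ℚ ≤ᵇ a in a≥0 | 0ℚ ≤ᵇ b in b≥0 | h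
  ... | true  | true  | _ = tt
  ... | true  | false | ℚ√2.b-negative _ _ q =
    0≤ᵇ-⇒≤ᵇ (two ℚ.* b ℚ.* b) (a ℚ.* a) (subst (λ z → T (0ℚ ≤ᵇ a ℚ.* a ℚ.- z)) (sym (two*b*b b)) q)
  ... | true  | false | ℚ√2.both-nonneg _ b≥0′ = ⊥-elim (≡false⇒¬T b≥0 b≥0′)
  ... | true  | false | ℚ√2.a-negative a<0 _ _ = ⊥-elim (a<0 (≡true⇒T a≥0))
  ... | false | true  | ℚ√2.a-negative _ _ q =
    0≤ᵇ-⇒≤ᵇ (a ℚ.* a) (two ℚ.* b ℚ.* b) (subst (λ z → T (0ℚ ≤ᵇ z ℚ.- a ℚ.* a)) (sym (two*b*b b)) q)
  ... | false | true  | ℚ√2.both-nonneg a≥0′ _ = ⊥-elim (≡false⇒¬T a≥0 a≥0′)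
  ... | false | true  | ℚ√2.b-negative a≥0′ _ _ = ⊥-elim (≡false⇒¬T a≥0 a≥0′)
  ... | false | false | ℚ√2.both-nonneg a≥0′ _ = ⊥-elim (≡false⇒¬T a≥0 a≥0′)
  ... | false | false | ℚ√2.b-negative a≥0′ _ _ = ⊥-elim (≡false⇒¬T a≥0 a≥0′)
  ... | false | false | ℚ√2.a-negative _ b≥0′ _ = ⊥-elim (≡false⇒¬T b≥0 b≥0′)

  0₂ 1₂ : Q2
  0₂ = q2 0ℚ 0ℚ
  1₂ = q2 1ℚ 0ℚ

  private
    q2-cong : ∀ {a b c e} → a ≡ c → b ≡ e → q2 a b ≡ q2 c e
    q2-cong = cong₂ q2

    +₂-assoc : ∀ x y z → (x +₂ y) +₂ z ≡ x +₂ (y +₂ z)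
    +₂-assoc (q2 a b) (q2 c e) (q2 f g) = q2-cong (ℚ.+-assoc a c f) (ℚ.+-assoc b e g)

    +₂-comm : ∀ x y → x +₂ y ≡ y +₂ x
    +₂-comm (q2 a b) (q2 c e) = q2-cong (ℚ.+-comm a c) (ℚ.+-comm b e)

    +₂-identityˡ : ∀ x → 0₂ +₂ x ≡ x
    +₂-identityˡ (q2 a b) = q2-cong (ℚ.+-identityˡ a) (ℚ.+-identityˡ b)

    +₂-identityʳ : ∀ x → x +₂ 0₂ ≡ x
    +₂-identityʳ (q2 a b) = q2-cong (ℚ.+-identityʳ a) (ℚ.+-identityʳ b)

    -₂‿inverseˡ : ∀ x → (-₂ x) +₂ x ≡ 0₂
    -₂‿inverseˡ (q2 a b) = q2-cong (ℚ.+-inverseˡ a) (ℚ.+-inverseˡ b)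

    -₂‿inverseʳ : ∀ x → x +₂ (-₂ x) ≡ 0₂
    -₂‿inverseʳ (q2 a b) = q2-cong (ℚ.+-inverseʳ a) (ℚ.+-inverseʳ b)

    *₂-assoc : ∀ x y z → (x *₂ y) *₂ z ≡ x *₂ (y *₂ z)
    *₂-assoc (q2 a b) (q2 c e) (q2 f g) = q2-cong
      (solve 7 (λ a b c e f g δ → (a :* c :+ δ :* b :* e) :* f :+ δ :* (a :* e :+ b :* c) :* g
                                := a :* (c :* f :+ δ :* e :* g) :+ δ :* b :* (c :* g :+ e :* f)) refl a b c e f g two)
      (solve 7 (λ a b c e f g δ → (a :* c :+ δ :* b :* e) :* g :+ (a :* e :+ b :* c) :* f
                                := a :* (c :* g :+ e :* f) :+ b :* (c :* f :+ δ :* e :* g)) refl a b c e f g two)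

    *₂-comm : ∀ x y → x *₂ y ≡ y *₂ x
    *₂-comm (q2 a b) (q2 c e) = q2-cong
      (solve 5 (λ a b c e δ → a :* c :+ δ :* b :* e := c :* a :+ δ :* e :* b) refl a b c e two)
      (solve 4 (λ a b c e → a :* e :+ b :* c := c :* b :+ e :* a) refl a b c e)

    *₂-identityˡ : ∀ x → 1₂ *₂ x ≡ x
    *₂-identityˡ (q2 a b) = q2-cong
      (solve 3 (λ a b δ → con (ℤ.+ 1) :* a :+ δ :* con (ℤ.+ 0) :* b := a) refl a b two)
      (solve 2 (λ a b → con (ℤ.+ 1) :* b :+ con (ℤ.+ 0) :* a := b) refl a b)

    *₂-identityʳ : ∀ x → x *₂ 1₂ ≡ x
    *₂-identityʳ x = trans (*₂-comm x 1₂) (*₂-identityˡ x)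

    *₂-distribˡ : ∀ x y z → x *₂ (y +₂ z) ≡ (x *₂ y) +₂ (x *₂ z)
    *₂-distribˡ (q2 a b) (q2 c e) (q2 f g) = q2-cong
      (solve 7 (λ a b c e f g δ → a :* (c :+ f) :+ δ :* b :* (e :+ g)
                                := (a :* c :+ δ :* b :* e) :+ (a :* f :+ δ :* b :* g)) refl a b c e f g two)
      (solve 6 (λ a b c e f g → a :* (e :+ g) :+ b :* (c :+ f) := (a :* e :+ b :* c) :+ (a :* g :+ b :* f)) refl a b c e f g)

    *₂-distribʳ : ∀ x y z → (y +₂ z) *₂ x ≡ (y *₂ x) +₂ (z *₂ x)
    *₂-distribʳ x y z = begin
      (y +₂ z) *₂ x          ≡⟨ *₂-comm (y +₂ z) x ⟩
      x *₂ (y +₂ z)          ≡⟨ *₂-distribˡ x y z ⟩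
      (x *₂ y) +₂ (x *₂ z)   ≡⟨ cong₂ _+₂_ (*₂-comm x y) (*₂-comm x z) ⟩
      (y *₂ x) +₂ (z *₂ x)   ∎
      where open ≡-Reasoning

  Q2-isCommutativeRing : IsCommutativeRing _≡_ _+₂_ _*₂_ -₂_ 0₂ 1₂
  Q2-isCommutativeRing = record
    { isRing = record
      { +-isAbelianGroup = record
        { isGroup = record
          { isMonoid = record
            { isSemigroup = record
              { isMagma = record { isEquivalence = isEquivalence ; ∙-cong = cong₂ _+₂_ }
              ; assoc = +₂-assoc }
            ; identity = +₂-identityˡ , +₂-identityʳ }
          ; inverse = -₂‿inverseˡ , -₂‿inverseʳ
          ; ⁻¹-cong = cong -₂_ }
        ; comm = +₂-comm }
      ; *-cong = cong₂ _*₂_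
      ; *-assoc = *₂-assoc
      ; *-identity = *₂-identityˡ , *₂-identityʳ
      ; distrib = (λ x y z → *₂-distribˡ x y z) , (λ x y z → *₂-distribʳ x y z)
      }
    ; *-comm = *₂-comm
    }

  private
    p-component : ∀ a b c e → q2 a b *₂ q2 c e ≡ 0₂ → a ℚ.* c ℚ.+ two ℚ.* (b ℚ.* e) ≡ 0ℚ
    p-component a b c e xy≡0 = trans (cong (a ℚ.* c ℚ.+_) (sym (ℚ.*-assoc two b e))) (cong Q2.p xy≡0)

    Q2-+-nonneg : ∀ x y → T (nonneg₂ x) → T (nonneg₂ y) → T (nonneg₂ (x +₂ y))
    Q2-+-nonneg (q2 a b) (q2 c e) x≥0 y≥0 = nonneg√⇒nonneg₂ (a ℚ.+ c) (b ℚ.+ e)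
      (ℚ√2.+-nonneg√ (nonneg₂⇒nonneg√ a b x≥0) (nonneg₂⇒nonneg√ c e y≥0))

    Q2-*-nonneg : ∀ x y → T (nonneg₂ x) → T (nonneg₂ y) → T (nonneg₂ (x *₂ y))
    Q2-*-nonneg (q2 a b) (q2 c e) x≥0 y≥0 =
      subst (λ z → T (nonneg₂ (q2 (a ℚ.* c ℚ.+ z) (a ℚ.* e ℚ.+ b ℚ.* c)))) (sym (ℚ.*-assoc two b e))
        (nonneg√⇒nonneg₂ (a ℚ.* c ℚ.+ two ℚ.* (b ℚ.* e)) (a ℚ.* e ℚ.+ b ℚ.* c)
          (ℚ√2.*-nonneg√ (nonneg₂⇒nonneg√ a b x≥0) (nonneg₂⇒nonneg√ c e y≥0)))

    Q2-nonneg-total : ∀ x → T (nonneg₂ x) ⊎ T (nonneg₂ (-₂ x))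
    Q2-nonneg-total (q2 a b) = Sum.map (nonneg√⇒nonneg₂ a b) (nonneg√⇒nonneg₂ (ℚ.- a) (ℚ.- b)) (ℚ√2.nonneg√-total a b)

    Q2-nonneg-antisym : ∀ x → T (nonneg₂ x) → T (nonneg₂ (-₂ x)) → x ≡ 0₂
    Q2-nonneg-antisym (q2 a b) x≥0 -x≥0 = uncurry q2-cong
      (ℚ√2.nonneg√-antisym √2-irrational (nonneg₂⇒nonneg√ a b x≥0) (nonneg₂⇒nonneg√ (ℚ.- a) (ℚ.- b) -x≥0))

    Q2-noZeroDivisors : ∀ x y → x *₂ y ≡ 0₂ → x ≡ 0₂ ⊎ y ≡ 0₂
    Q2-noZeroDivisors (q2 a b) (q2 c e) xy≡0 = Sum.map (uncurry q2-cong) (uncurry q2-cong)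
      (ℚ√2.noZeroDivisors√ √2-irrational {a} {b} {c} {e} (p-component a b c e xy≡0) (cong Q2.q xy≡0))

  Q2-decOrderedDomain : DecOrderedDomain
  Q2-decOrderedDomain = record
    { Carrier = Q2 ; _+_ = _+₂_ ; _*_ = _*₂_ ; -_ = -₂_ ; 0# = 0₂ ; 1# = 1₂
    ; isCommutativeRing = Q2-isCommutativeRing
    ; nonnegᵇ = nonneg₂
    ; +-nonneg = λ {x} {y} → Q2-+-nonneg x y
    ; *-nonneg = λ {x} {y} → Q2-*-nonneg x y
    ; nonneg-total = Q2-nonneg-total
    ; nonneg-antisym = λ {x} → Q2-nonneg-antisym x
    ; noZeroDivisors = λ {x} {y} → Q2-noZeroDivisors x y
    }

module OrderOnK where

  open import Algebra.Structures using (IsCommutativeMonoid)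
  open import Data.Bool using (true; false; T)
  open import Data.Empty using (⊥-elim)
  open import Data.Nat as ℕ using (ℕ; zero; suc)
  import Data.Nat.Properties as ℕ
  open import Data.Product using (_×_; _,_; proj₂)
  open import Data.Sum using (inj₁; inj₂)
  open import Data.Unit using (tt)
  open import Relation.Binary.Bundles using (Preorder)
  open import Relation.Binary.Structures using (IsPreorder)
  open import Relation.Binary.PropositionalEquality
  open import Relation.Nullary using (¬_)

  open OrderedDomains
  open RealQuadratic

  module K√3 = QuadraticExtension Q2-decOrderedDomain three₂ tt

  private
    open module Q2-props = DecOrderedDomainProperties Q2-decOrderedDomain
      using (solve; _:+_; _:-_; _:=_; :-_)

  nonnegK⇒nonneg√ : ∀ x y → T (nonnegK (k3 x y)) → K√3.NonNeg√ x y
  nonnegK⇒nonneg√ x y h with nonneg₂ x in x≥0 | nonneg₂ y in y≥0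
  ... | true  | true  = K√3.both-nonneg (≡true⇒T x≥0) (≡true⇒T y≥0)
  ... | true  | false = K√3.b-negative (≡true⇒T x≥0) (≡false⇒¬T y≥0) h
  ... | false | true  = K√3.a-negative (≡false⇒¬T x≥0) (≡true⇒T y≥0) h

  nonneg√⇒nonnegK : ∀ x y → K√3.NonNeg√ x y → T (nonnegK (k3 x y))
  nonneg√⇒nonnegK x y h with nonneg₂ x in x≥0 | nonneg₂ y in y≥0 | h
  ... | true  | true  | _ = tt
  ... | true  | false | K√3.b-negative _ _ q = q
  ... | true  | false | K√3.both-nonneg _ y≥0′ = ⊥-elim (≡false⇒¬T y≥0 y≥0′)
  ... | true  | false | K√3.a-negative x<0 _ _ = ⊥-elim (x<0 (≡true⇒T x≥0))
  ... | false | true  | K√3.a-negative _ _ q = q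
  ... | false | true  | K√3.both-nonneg x≥0′ _ = ⊥-elim (≡false⇒¬T x≥0 x≥0′)
  ... | false | true  | K√3.b-negative x≥0′ _ _ = ⊥-elim (≡false⇒¬T x≥0 x≥0′)
  ... | false | false | K√3.both-nonneg x≥0′ _ = ⊥-elim (≡false⇒¬T x≥0 x≥0′)
  ... | false | false | K√3.b-negative x≥0′ _ _ = ⊥-elim (≡false⇒¬T x≥0 x≥0′)
  ... | false | false | K√3.a-negative _ y≥0′ _ = ⊥-elim (≡false⇒¬T y≥0 y≥0′)

  nonnegK-+ : ∀ {u v} → T (nonnegK u) → T (nonnegK v) → T (nonnegK (u +K v))
  nonnegK-+ {k3 x y} {k3 x′ y′} u≥0 v≥0 = nonneg√⇒nonnegK (x +₂ x′) (y +₂ y′)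
    (K√3.+-nonneg√ (nonnegK⇒nonneg√ x y u≥0) (nonnegK⇒nonneg√ x′ y′ v≥0))

  private
    k3-cong : ∀ {x y x′ y′} → x ≡ x′ → y ≡ y′ → k3 x y ≡ k3 x′ y′
    k3-cong = cong₂ k3

    sub-+-sub : ∀ a b c e → (b +K e) +K (-K (a +K c)) ≡ (b +K (-K a)) +K (e +K (-K c))
    sub-+-sub (k3 x₁ y₁) (k3 x₂ y₂) (k3 x₃ y₃) (k3 x₄ y₄) = k3-cong (identity x₁ x₂ x₃ x₄) (identity y₁ y₂ y₃ y₄)
      where identity = solve 4 (λ a b c e → (b :+ e) :- (a :+ c) := (b :- a) :+ (e :- c)) refl

  +K-assoc : ∀ a b c → (a +K b) +K c ≡ a +K (b +K c)
  +K-assoc (k3 x y) (k3 x′ y′) (k3 x″ y″) = k3-cong (Q2-props.+-assoc x x′ x″) (Q2-props.+-assoc y y′ y″)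

  +K-comm : ∀ a b → a +K b ≡ b +K a
  +K-comm (k3 x y) (k3 x′ y′) = k3-cong (Q2-props.+-comm x x′) (Q2-props.+-comm y y′)

  +K-identityˡ : ∀ a → 0K +K a ≡ a
  +K-identityˡ (k3 x y) = k3-cong (Q2-props.+-identityˡ x) (Q2-props.+-identityˡ y)

  +K-identityʳ : ∀ a → a +K 0K ≡ a
  +K-identityʳ (k3 x y) = k3-cong (Q2-props.+-identityʳ x) (Q2-props.+-identityʳ y)

  +K-inverseʳ : ∀ a → a +K (-K a) ≡ 0K
  +K-inverseʳ (k3 x y) = k3-cong (Q2-props.-‿inverseʳ x) (Q2-props.-‿inverseʳ y)

  +K-isCommutativeMonoid : IsCommutativeMonoid _≡_ _+K_ 0K
  +K-isCommutativeMonoid = record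
    { isMonoid = record
      { isSemigroup = record
        { isMagma = record { isEquivalence = isEquivalence ; ∙-cong = cong₂ _+K_ }
        ; assoc = +K-assoc }
      ; identity = +K-identityˡ , +K-identityʳ }
    ; comm = +K-comm }

  ≤K-reflexive : ∀ {a b} → a ≡ b → a ≤K b
  ≤K-reflexive {a} refl = subst (T ∘′ nonnegK) (sym (+K-inverseʳ a)) tt
    where open import Function using (_∘′_)

  ≤K-refl : ∀ {a} → a ≤K a
  ≤K-refl {a} = ≤K-reflexive {a} refl

  +K-mono-≤ : ∀ {a b c e} → a ≤K b → c ≤K e → (a +K c) ≤K (b +K e)
  +K-mono-≤ {a} {b} {c} {e} a≤b c≤e = subst (λ z → T (nonnegK z)) (sym (sub-+-sub a b c e)) (nonnegK-+ {b +K (-K a)} {e +K (-K c)} a≤b c≤e)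

  ≤K-trans : ∀ {a b c} → a ≤K b → b ≤K c → a ≤K c
  ≤K-trans {a} {b} {c} a≤b b≤c = subst (λ z → T (nonnegK z)) (lemma a b c) (nonnegK-+ {c +K (-K b)} {b +K (-K a)} b≤c a≤b)
    where
    lemma : ∀ a b c → (c +K (-K b)) +K (b +K (-K a)) ≡ c +K (-K a)
    lemma (k3 x₁ y₁) (k3 x₂ y₂) (k3 x₃ y₃) = k3-cong (identity x₁ x₂ x₃) (identity y₁ y₂ y₃)
      where identity = solve 3 (λ a b c → (c :- b) :+ (b :- a) := c :- a) refl

  ≤K-isPreorder : IsPreorder _≡_ _≤K_
  ≤K-isPreorder = record
    { isEquivalence = isEquivalence ; reflexive = ≤K-reflexive ; trans = λ {a} {b} {c} → ≤K-trans {a} {b} {c} }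

  ≤K-preorder : Preorder _ _ _
  ≤K-preorder = record { isPreorder = ≤K-isPreorder }

  +K-cancelˡ-≤ : ∀ a {b c} → (a +K b) ≤K (a +K c) → b ≤K c
  +K-cancelˡ-≤ a {b} {c} = subst (λ z → T (nonnegK z)) (lemma a b c)
    where
    lemma : ∀ a b c → (a +K c) +K (-K (a +K b)) ≡ c +K (-K b)
    lemma (k3 x₁ y₁) (k3 x₂ y₂) (k3 x₃ y₃) = k3-cong (identity x₁ x₂ x₃) (identity y₁ y₂ y₃)
      where identity = solve 3 (λ a b c → (a :+ c) :- (a :+ b) := c :- b) refl

  infix 4 _<K_
  _<K_ : K → K → Set
  a <K b = a ≤K b × ¬ (b ≤K a)

  +K-mono-≤-< : ∀ {a b c e} → a ≤K b → c <K e → (a +K c) <K (b +K e)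
  +K-mono-≤-< {a} {b} {c} {e} a≤b (c≤e , e≰c) =
    +K-mono-≤ {a} {b} {c} {e} a≤b c≤e ,
    λ b+e≤a+c → e≰c (+K-cancelˡ-≤ b (≤K-trans {b +K e} {a +K c} {b +K c} b+e≤a+c (+K-mono-≤ {a} {b} {c} {c} a≤b (≤K-refl {c}))))

  ·K-distrib-+ : ∀ m n a → (m ℕ.+ n) ·K a ≡ (m ·K a) +K (n ·K a)
  ·K-distrib-+ zero n a = sym (+K-identityˡ (n ·K a))
  ·K-distrib-+ (suc m) n a = trans (cong (a +K_) (·K-distrib-+ m n a)) (sym (+K-assoc a (m ·K a) (n ·K a)))

  ·K-nonneg : ∀ n {a} → 0K ≤K a → 0K ≤K (n ·K a)
  ·K-nonneg zero a≥0 = ≤K-refl {0K}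
  ·K-nonneg (suc n) {a} a≥0 = subst (_≤K (a +K (n ·K a))) (+K-identityˡ 0K)
    (+K-mono-≤ {0K} {a} {0K} {n ·K a} a≥0 (·K-nonneg n a≥0))

  ·K-cancel-≤ : ∀ {m n a} → 0K <K a → (m ·K a) ≤K (n ·K a) → m ℕ.≤ n
  ·K-cancel-≤ {m} {n} {a} a>0@(a≥0 , _) ma≤na with ℕ.≤-total m n
  ... | inj₁ m≤n = m≤n
  ... | inj₂ n≤m with ℕ.m≤n⇒∃[o]m+o≡n n≤m
  ...   | zero , n+0≡m = ℕ.≤-reflexive (trans (sym n+0≡m) (ℕ.+-identityʳ n))
  ...   | suc o , n+o≡m = ⊥-elim (proj₂ oa+a>0 oa+a≤0)
    where
    oa+a>0 : (0K +K 0K) <K ((o ·K a) +K a)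
    oa+a>0 = +K-mono-≤-< {0K} {o ·K a} {0K} {a} (·K-nonneg o a≥0) a>0
    na+[oa+a]≤na+0 : ((n ·K a) +K ((o ·K a) +K a)) ≤K ((n ·K a) +K (0K +K 0K))
    na+[oa+a]≤na+0 = subst₂ _≤K_
      (trans (cong (_·K a) (sym n+o≡m)) (trans (·K-distrib-+ n (suc o) a) (cong ((n ·K a) +K_) (+K-comm a (o ·K a)))))
      (sym (trans (cong ((n ·K a) +K_) (+K-identityˡ 0K)) (+K-identityʳ (n ·K a))))
      ma≤na
    oa+a≤0 : ((o ·K a) +K a) ≤K (0K +K 0K)
    oa+a≤0 = +K-cancelˡ-≤ (n ·K a) na+[oa+a]≤na+0

  +K-mono-<-≤ : ∀ {a b c e} → a <K b → c ≤K e → (a +K c) <K (b +K e)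
  +K-mono-<-≤ {a} {b} {c} {e} a<b c≤e =
    subst₂ _<K_ (+K-comm c a) (+K-comm e b) (+K-mono-≤-< {c} {e} {a} {b} c≤e a<b)

  <K-≤K-trans : ∀ {a b c} → a <K b → b ≤K c → a <K c
  <K-≤K-trans {a} {b} {c} (a≤b , b≰a) b≤c = ≤K-trans {a} {b} {c} a≤b b≤c , λ c≤a → b≰a (≤K-trans {b} {c} {a} b≤c c≤a)

module ListSums where

  open import Algebra.Core using (Op₂)
  open import Algebra.Structures using (IsCommutativeMonoid)
  open import Data.Bool using (Bool; true; false; _∧_; _∨_; not; if_then_else_)
  open import Data.List using (List; []; _∷_; map; foldr)
  open import Data.List.Membership.Propositional using (_∈_)
  import Data.List.Membership.DecPropositional as DecMembership
  open import Data.List.Relation.Unary.All as All using (All; []; _∷_)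
  open import Data.List.Relation.Unary.Any using (here; there)
  open import Data.List.Relation.Unary.AllPairs using ([]; _∷_)
  open import Data.List.Relation.Unary.Unique.Propositional using (Unique)
  open import Relation.Binary.Definitions using (DecidableEquality)
  open import Relation.Binary.PropositionalEquality
  open import Relation.Nullary using (¬_; does; yes; no)
  open import Relation.Nullary.Decidable using (dec-true; dec-false)

  module ListSum {C : Set} {_∙_ : Op₂ C} {ε : C} (isCommutativeMonoid : IsCommutativeMonoid _≡_ _∙_ ε) where
    open IsCommutativeMonoid isCommutativeMonoid using (assoc; comm; identityˡ; identityʳ)
    open ≡-Reasoning

    private variable A B : Set

    ∑ : List A → (A → C) → C
    ∑ [] f = ε
    ∑ (x ∷ xs) f = f x ∙ ∑ xs f

    infix 25 [_]?_
    [_]?_ : Bool → C → C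
    [ b ]? c = if b then c else ε

    private
      interchange : ∀ a b c e → (a ∙ b) ∙ (c ∙ e) ≡ (a ∙ c) ∙ (b ∙ e)
      interchange a b c e = begin
        (a ∙ b) ∙ (c ∙ e)   ≡⟨ assoc a b (c ∙ e) ⟩
        a ∙ (b ∙ (c ∙ e))   ≡⟨ cong (a ∙_) (sym (assoc b c e)) ⟩
        a ∙ ((b ∙ c) ∙ e)   ≡⟨ cong (λ z → a ∙ (z ∙ e)) (comm b c) ⟩
        a ∙ ((c ∙ b) ∙ e)   ≡⟨ cong (a ∙_) (assoc c b e) ⟩
        a ∙ (c ∙ (b ∙ e))   ≡⟨ sym (assoc a c (b ∙ e)) ⟩
        (a ∙ c) ∙ (b ∙ e)   ∎

    foldr-if : ∀ (P : A → Bool) (f : A → C) (z : C) (xs : List A) →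
               foldr (λ x acc → if P x then f x ∙ acc else acc) z xs ≡ ∑ xs (λ x → [ P x ]? f x) ∙ z
    foldr-if P f z [] = sym (identityˡ z)
    foldr-if P f z (x ∷ xs) with P x
    ... | true = trans (cong (f x ∙_) (foldr-if P f z xs)) (sym (assoc (f x) _ z))
    ... | false = trans (foldr-if P f z xs) (cong (_∙ z) (sym (identityˡ _)))

    ∑-cong : ∀ (xs : List A) {f g : A → C} → (∀ x → f x ≡ g x) → ∑ xs f ≡ ∑ xs g
    ∑-cong [] f≗g = refl
    ∑-cong (x ∷ xs) f≗g = cong₂ _∙_ (f≗g x) (∑-cong xs f≗g)

    ∑-ε : ∀ (xs : List A) → ∑ xs (λ _ → ε) ≡ ε
    ∑-ε [] = refl
    ∑-ε (x ∷ xs) = trans (identityˡ _) (∑-ε xs)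

    ∑-distrib : ∀ (xs : List A) (f g : A → C) → ∑ xs (λ x → f x ∙ g x) ≡ ∑ xs f ∙ ∑ xs g
    ∑-distrib [] f g = sym (identityˡ ε)
    ∑-distrib (x ∷ xs) f g = trans (cong ((f x ∙ g x) ∙_) (∑-distrib xs f g)) (interchange (f x) (g x) _ _)

    ∑-comm : ∀ (xs : List A) (ys : List B) (f : A → B → C) →
             ∑ xs (λ x → ∑ ys (f x)) ≡ ∑ ys (λ y → ∑ xs (λ x → f x y))
    ∑-comm [] ys f = sym (∑-ε ys)
    ∑-comm (x ∷ xs) ys f = trans (cong (∑ ys (f x) ∙_) (∑-comm xs ys f)) (sym (∑-distrib ys (f x) _))

    ∑-map : ∀ (g : A → B) (xs : List A) (f : B → C) → ∑ (map g xs) f ≡ ∑ xs (λ x → f (g x))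
    ∑-map g [] f = refl
    ∑-map g (x ∷ xs) f = cong (f (g x) ∙_) (∑-map g xs f)

    ∑-split : ∀ (xs : List A) (P : A → Bool) (f : A → C) →
              ∑ xs f ≡ ∑ xs (λ x → [ P x ]? f x) ∙ ∑ xs (λ x → [ not (P x) ]? f x)
    ∑-split xs P f = trans (∑-cong xs (λ x → split (P x) (f x))) (∑-distrib xs _ _)
      where
      split : ∀ b c → c ≡ [ b ]? c ∙ [ not b ]? c
      split true c = sym (identityʳ c)
      split false c = sym (identityˡ c)

    ∑-[]?-false : ∀ (xs : List A) (P : A → Bool) (f : A → C) → All (λ x → P x ≡ false) xs →
                  ∑ xs (λ x → [ P x ]? f x) ≡ ε
    ∑-[]?-false [] P f [] = refl
    ∑-[]?-false (x ∷ xs) P f (Px≡false ∷ rest) rewrite Px≡false = trans (identityˡ _) (∑-[]?-false xs P f rest)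

    []?-∧ : ∀ a b c → [ a ]? ([ b ]? c) ≡ [ a ∧ b ]? c
    []?-∧ true b c = refl
    []?-∧ false b c = refl

    []?-∙ : ∀ b x y → [ b ]? (x ∙ y) ≡ [ b ]? x ∙ [ b ]? y
    []?-∙ true x y = refl
    []?-∙ false x y = sym (identityˡ ε)

    []?-ε : ∀ b → [ b ]? ε ≡ ε
    []?-ε true = refl
    []?-ε false = refl

    module _ (_≟_ : DecidableEquality A) where
      open DecMembership _≟_ using (_∈?_)

      ∑-point : ∀ (xs : List A) (f : A → C) {y} → Unique xs → y ∈ xs → ∑ xs (λ x → [ does (x ≟ y) ]? f x) ≡ f y
      ∑-point (x ∷ xs) f (x∉xs ∷ _) (here refl) rewrite dec-true (x ≟ x) refl =
        trans (cong (f x ∙_) (∑-[]?-false xs _ f (others x∉xs))) (identityʳ (f x))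
        where
        others : ∀ {zs} → All (x ≢_) zs → All (λ z → does (z ≟ x) ≡ false) zs
        others [] = []
        others (x≢z ∷ rest) = dec-false (_ ≟ x) (λ z≡x → x≢z (sym z≡x)) ∷ others rest
      ∑-point (x ∷ xs) f {y} (x∉xs ∷ xs-unique) (there y∈xs) rewrite dec-false (x ≟ y) (All.lookup x∉xs y∈xs) =
        trans (identityˡ _) (∑-point xs f xs-unique y∈xs)

      ∑-∈? : ∀ (us : List A) → Unique us → (∀ x → x ∈ us) → ∀ (xs : List A) (f : A → C) → Unique xs →
             ∑ us (λ u → [ does (u ∈? xs) ]? f u) ≡ ∑ xs f
      ∑-∈? us us-unique complete [] f [] = ∑-ε us
      ∑-∈? us us-unique complete (y ∷ xs) f (y∉xs ∷ xs-unique) = begin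
        ∑ us (λ u → [ does (u ≟ y) ∨ does (u ∈? xs) ]? f u)
          ≡⟨ ∑-cong us split ⟩
        ∑ us (λ u → [ does (u ≟ y) ]? f u ∙ [ does (u ∈? xs) ]? f u)
          ≡⟨ ∑-distrib us _ _ ⟩
        ∑ us (λ u → [ does (u ≟ y) ]? f u) ∙ ∑ us (λ u → [ does (u ∈? xs) ]? f u)
          ≡⟨ cong₂ _∙_ (∑-point us f us-unique (complete y)) (∑-∈? us us-unique complete xs f xs-unique) ⟩
        f y ∙ ∑ xs f ∎
        where
        y∉xs′ : ¬ y ∈ xs
        y∉xs′ y∈xs = All.lookup y∉xs y∈xs refl
        split : ∀ u → [ does (u ≟ y) ∨ does (u ∈? xs) ]? f u ≡ [ does (u ≟ y) ]? f u ∙ [ does (u ∈? xs) ]? f u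
        split u with u ≟ y
        ... | yes refl rewrite dec-false (u ∈? xs) y∉xs′ = sym (identityʳ (f u))
        ... | no _ = sym (identityˡ _)

module ChargeTable where

  open import Data.Integer as ℤ using ()
  open import Data.Nat using (ℕ; suc; _≤_; s≤s)
  open import Data.Empty using (⊥-elim)
  open import Data.Product using (_×_; _,_)
  open import Data.Sum using (_⊎_; inj₁; inj₂)
  open import Data.Rational as ℚ using (0ℚ)
  open import Data.Unit using (tt)
  open import Relation.Binary.PropositionalEquality using (_≡_; _≢_; refl)

  open OrderOnK

  data Degree1to3 : ℕ → Set where
    deg1 : Degree1to3 1
    deg2 : Degree1to3 2
    deg3 : Degree1to3 3

  degree1to3 : ∀ {a} → 1 ≤ a → a ≤ 3 → Degree1to3 a
  degree1to3 {1} _ _ = deg1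
  degree1to3 {2} _ _ = deg2
  degree1to3 {3} _ _ = deg3
  degree1to3 {suc (suc (suc (suc _)))} _ (s≤s (s≤s (s≤s ())))

  -- share a b is the part of the weight 1/√(ab) of an edge between two matched vertices
  -- of degrees a and b that is charged to the endpoint of degree a
  share : ℕ → ℕ → K
  share 1 1 = ofℚ (ℤ.+ 1 ℚ./ 2)
  share 1 2 = k3 (q2 0ℚ (ℤ.+ 1 ℚ./ 4)) (q2 0ℚ 0ℚ)
  share 2 1 = k3 (q2 0ℚ (ℤ.+ 1 ℚ./ 4)) (q2 0ℚ 0ℚ)
  share 1 3 = k3 (q2 0ℚ 0ℚ) (q2 (ℤ.+ 1 ℚ./ 6) 0ℚ)
  share 3 1 = k3 (q2 0ℚ 0ℚ) (q2 (ℤ.+ 1 ℚ./ 6) 0ℚ)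
  share 2 2 = ofℚ (ℤ.+ 1 ℚ./ 4)
  share 2 3 = ofℚ (ℤ.+ 5 ℚ./ 24)
  share 3 2 = k3 (q2 (ℚ.- (ℤ.+ 5 ℚ./ 24)) 0ℚ) (q2 0ℚ (ℤ.+ 1 ℚ./ 6))
  share 3 3 = ofℚ (ℤ.+ 1 ℚ./ 6)
  share _ _ = 0K

  -- a lower bound for what a matched vertex of degree a receives from each of its edges
  minCharge : ℕ → K
  minCharge 2 = ofℚ (ℤ.+ 5 ℚ./ 24)
  minCharge 3 = ofℚ (ℤ.+ 1 ℚ./ 6)
  minCharge _ = 0K

  share-sum : ∀ {a b} → Degree1to3 a → Degree1to3 b → (share a b +K share b a) ≡ invSqrtProd a b
  share-sum deg1 deg1 = refl
  share-sum deg1 deg2 = refl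
  share-sum deg1 deg3 = refl
  share-sum deg2 deg1 = refl
  share-sum deg2 deg2 = refl
  share-sum deg2 deg3 = refl
  share-sum deg3 deg1 = refl
  share-sum deg3 deg2 = refl
  share-sum deg3 deg3 = refl

  invSqrtProd-comm : ∀ {a b} → Degree1to3 a → Degree1to3 b → invSqrtProd a b ≡ invSqrtProd b a
  invSqrtProd-comm deg1 deg1 = refl
  invSqrtProd-comm deg1 deg2 = refl
  invSqrtProd-comm deg1 deg3 = refl
  invSqrtProd-comm deg2 deg1 = refl
  invSqrtProd-comm deg2 deg2 = refl
  invSqrtProd-comm deg2 deg3 = refl
  invSqrtProd-comm deg3 deg1 = refl
  invSqrtProd-comm deg3 deg2 = refl
  invSqrtProd-comm deg3 deg3 = refl

  minCharge≤share : ∀ {a b} → Degree1to3 a → Degree1to3 b → minCharge a ≤K share a b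
  minCharge≤share deg1 deg1 = tt
  minCharge≤share deg1 deg2 = tt
  minCharge≤share deg1 deg3 = tt
  minCharge≤share deg2 deg1 = tt
  minCharge≤share deg2 deg2 = tt
  minCharge≤share deg2 deg3 = tt
  minCharge≤share deg3 deg1 = tt
  minCharge≤share deg3 deg2 = tt
  minCharge≤share deg3 deg3 = tt

  minCharge≤invSqrtProd : ∀ {a b} → Degree1to3 a → Degree1to3 b → minCharge a ≤K invSqrtProd a b
  minCharge≤invSqrtProd deg1 deg1 = tt
  minCharge≤invSqrtProd deg1 deg2 = tt
  minCharge≤invSqrtProd deg1 deg3 = tt
  minCharge≤invSqrtProd deg2 deg1 = tt
  minCharge≤invSqrtProd deg2 deg2 = tt
  minCharge≤invSqrtProd deg2 deg3 = tt
  minCharge≤invSqrtProd deg3 deg1 = tt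
  minCharge≤invSqrtProd deg3 deg2 = tt
  minCharge≤invSqrtProd deg3 deg3 = tt

  -- what a matching edge ab with 1 + i = deg a, 1 + j = deg b receives at least
  edgeBound : ℕ → ℕ → K
  edgeBound i j = (share (suc i) (suc j) +K (i ·K minCharge (suc i))) +K (share (suc j) (suc i) +K (j ·K minCharge (suc j)))

  edgeBound-≥c₃ : ∀ {i j} → Degree1to3 (suc i) → Degree1to3 (suc j) → c₃ ≤K edgeBound i j
  edgeBound-≥c₃ deg1 deg1 = tt
  edgeBound-≥c₃ deg1 deg2 = tt
  edgeBound-≥c₃ deg1 deg3 = tt
  edgeBound-≥c₃ deg2 deg1 = tt
  edgeBound-≥c₃ deg2 deg2 = tt
  edgeBound-≥c₃ deg2 deg3 = tt
  edgeBound-≥c₃ deg3 deg1 = tt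
  edgeBound-≥c₃ deg3 deg2 = tt
  edgeBound-≥c₃ deg3 deg3 = tt

  edgeBound->c₃ : ∀ {i j} → Degree1to3 (suc i) → Degree1to3 (suc j) →
                  (i ≡ 0 × j ≡ 2) ⊎ (i ≡ 2 × j ≡ 0) ⊎ c₃ <K edgeBound i j
  edgeBound->c₃ deg1 deg1 = inj₂ (inj₂ (tt , λ ()))
  edgeBound->c₃ deg1 deg2 = inj₂ (inj₂ (tt , λ ()))
  edgeBound->c₃ deg1 deg3 = inj₁ (refl , refl)
  edgeBound->c₃ deg2 deg1 = inj₂ (inj₂ (tt , λ ()))
  edgeBound->c₃ deg2 deg2 = inj₂ (inj₂ (tt , λ ()))
  edgeBound->c₃ deg2 deg3 = inj₂ (inj₂ (tt , λ ()))
  edgeBound->c₃ deg3 deg1 = inj₂ (inj₁ (refl , refl))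
  edgeBound->c₃ deg3 deg2 = inj₂ (inj₂ (tt , λ ()))
  edgeBound->c₃ deg3 deg3 = inj₂ (inj₂ (tt , λ ()))

  edgeBound-pendant : edgeBound 2 0 ≡ c₃
  edgeBound-pendant = refl

  minCharge₃<invSqrtProd : ∀ {b} → Degree1to3 b → minCharge 3 <K invSqrtProd 3 b
  minCharge₃<invSqrtProd deg1 = tt , λ ()
  minCharge₃<invSqrtProd deg2 = tt , λ ()
  minCharge₃<invSqrtProd deg3 = tt , λ ()

  minCharge₃<share : ∀ {b} → Degree1to3 b → b ≢ 3 → minCharge 3 <K share 3 b
  minCharge₃<share deg1 _ = tt , λ ()
  minCharge₃<share deg2 _ = tt , λ ()
  minCharge₃<share deg3 3≢3 = ⊥-elim (3≢3 refl)

  c₃>0 : 0K <K c₃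
  c₃>0 = tt , λ ()

module Discharging where

  open import Data.Bool as Bool using (Bool; true; false; _∧_; not; if_then_else_)
  open import Data.Empty using (⊥-elim)
  open import Data.Fin using (Fin; toℕ)
  open import Data.Fin.Properties using (_≟_; toℕ-injective)
  open import Data.List using (List; []; _∷_; allFin; foldr; length)
  open import Data.List.Membership.Propositional using (_∈_; lose)
  open import Data.List.Membership.Propositional.Properties using (∈-allFin)
  import Data.List.Membership.DecPropositional as DecMembership
  open import Data.List.Relation.Unary.Any using (Any; here; there; any?; satisfied)
  open import Data.List.Relation.Unary.Unique.Propositional using (Unique)
  open import Data.List.Relation.Unary.Unique.Propositional.Properties using (allFin⁺)
  open import Data.Nat as ℕ using (ℕ; suc; _≤_; z≤n; s≤s)
  import Data.Nat.Properties as ℕ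
  open import Data.Product using (∃; _×_; _,_; proj₁; proj₂)
  open import Data.Sum as Sum using (_⊎_; inj₁; inj₂)
  open import Relation.Binary.Definitions using (tri<; tri≈; tri>)
  open import Relation.Binary.PropositionalEquality
  import Relation.Binary.Reasoning.Preorder
  open import Relation.Nullary using (¬_; Dec; does; yes; no; ¬?)
  open import Relation.Nullary.Decidable using (dec-true; dec-false; _×-dec_; decidable-stable)

  open OrderOnK
  open ListSums
  open ChargeTable

  module ℕ∑ = ListSum ℕ.+-0-isCommutativeMonoid
  open ListSum +K-isCommutativeMonoid

  count : ∀ {A : Set} → List A → (A → Bool) → ℕ
  count xs P = ℕ∑.∑ xs (λ x → ℕ∑.[ P x ]? 1)

  count≥1 : ∀ {A : Set} (xs : List A) (P : A → Bool) {x} → x ∈ xs → P x ≡ true → 1 ≤ count xs P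
  count≥1 (y ∷ xs) P (here refl) Py≡true rewrite Py≡true = s≤s z≤n
  count≥1 (y ∷ xs) P (there x∈xs) Px≡true =
    ℕ.≤-trans (count≥1 xs P x∈xs Px≡true) (ℕ.m≤n+m (count xs P) (ℕ∑.[ P y ]? 1))

  count≢0⇒∃ : ∀ {A : Set} (xs : List A) (P : A → Bool) → count xs P ≢ 0 → ∃ λ x → P x ≡ true
  count≢0⇒∃ [] P count≢0 = ⊥-elim (count≢0 refl)
  count≢0⇒∃ (x ∷ xs) P count≢0 with P x in Px
  ... | true = x , Px
  ... | false = count≢0⇒∃ xs P count≢0

  deg≡count : ∀ {n} (G : Graph n) u → deg G u ≡ count (allFin n) (adj G u)
  deg≡count {n} G u = trans (ℕ∑.foldr-if (adj G u) (λ _ → 1) 0 (allFin n)) (ℕ.+-identityʳ _)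

  adj⇒≢ : ∀ {n} (G : Graph n) {u v} → adj G u v ≡ true → u ≢ v
  adj⇒≢ G {u} uv∈E refl with trans (sym (adj-irr G u)) uv∈E
  ... | ()

  adj⇒deg≥1 : ∀ {n} (G : Graph n) {u v} → adj G u v ≡ true → 1 ≤ deg G u
  adj⇒deg≥1 {n} G {u} {v} uv∈E = subst (1 ≤_) (sym (deg≡count G u)) (count≥1 (allFin n) (adj G u) (∈-allFin v) uv∈E)

  adj⇒degree1to3 : ∀ {n} (G : Graph n) → MaxDegreeAtMost G 3 → ∀ {u v} → adj G u v ≡ true → Degree1to3 (deg G u)
  adj⇒degree1to3 G Δ≤3 {u} uv∈E = degree1to3 (adj⇒deg≥1 G uv∈E) (Δ≤3 u)

  ∑-≥-count : ∀ {A : Set} (xs : List A) (P : A → Bool) (g : A → K) (L : K) →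
              (∀ x → x ∈ xs → P x ≡ true → L ≤K g x) → (count xs P ·K L) ≤K ∑ xs (λ x → [ P x ]? g x)
  ∑-≥-count [] P g L L≤g = ≤K-refl {0K}
  ∑-≥-count (x ∷ xs) P g L L≤g with P x in Px
  ... | true = +K-mono-≤ {L} {g x} {count xs P ·K L} {∑ xs (λ x → [ P x ]? g x)}
                 (L≤g x (here refl) Px) (∑-≥-count xs P g L (λ y y∈xs → L≤g y (there y∈xs)))
  ... | false = subst (λ z → (count xs P ·K L) ≤K z) (sym (+K-identityˡ (∑ xs (λ x → [ P x ]? g x))))
                  (∑-≥-count xs P g L (λ y y∈xs → L≤g y (there y∈xs)))

  ∑->-count : ∀ {A : Set} (xs : List A) (P : A → Bool) (g : A → K) (L : K) →
              (∀ x → x ∈ xs → P x ≡ true → L ≤K g x) → Any (λ x → P x ≡ true × L <K g x) xs →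
              (count xs P ·K L) <K ∑ xs (λ x → [ P x ]? g x)
  ∑->-count (x ∷ xs) P g L L≤g (here (Px , L<gx)) rewrite Px =
    +K-mono-<-≤ {L} {g x} {count xs P ·K L} {∑ xs (λ x → [ P x ]? g x)}
      L<gx (∑-≥-count xs P g L (λ y y∈xs → L≤g y (there y∈xs)))
  ∑->-count (x ∷ xs) P g L L≤g (there strict) with P x in Px
  ... | true = +K-mono-≤-< {L} {g x} {count xs P ·K L} {∑ xs (λ x → [ P x ]? g x)}
                 (L≤g x (here refl) Px) (∑->-count xs P g L (λ y y∈xs → L≤g y (there y∈xs)) strict)
  ... | false = subst (λ z → (count xs P ·K L) <K z) (sym (+K-identityˡ (∑ xs (λ x → [ P x ]? g x))))
                  (∑->-count xs P g L (λ y y∈xs → L≤g y (there y∈xs)) strict)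

  ∑-exact : ∀ {A : Set} (xs : List A) (P : A → Bool) (g : A → K) (c : K) →
            (∀ x → P x ≡ true → g x ≡ c) → ∑ xs (λ x → [ P x ]? g x) ≡ (count xs P ·K c)
  ∑-exact [] P g c g≡c = refl
  ∑-exact (x ∷ xs) P g c g≡c with P x in Px
  ... | true = cong₂ _+K_ (g≡c x Px) (∑-exact xs P g c g≡c)
  ... | false = trans (+K-identityˡ _) (∑-exact xs P g c g≡c)

  ∑-const : ∀ {A : Set} (xs : List A) (c : K) → ∑ xs (λ _ → c) ≡ (length xs ·K c)
  ∑-const [] c = refl
  ∑-const (x ∷ xs) c = cong (c +K_) (∑-const xs c)

  count-true≡length : ∀ {A : Set} (xs : List A) → count xs (λ _ → true) ≡ length xs
  count-true≡length [] = refl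
  count-true≡length (x ∷ xs) = cong suc (count-true≡length xs)

  -- what the edge uv hands to u, given whether u and v are matched
  charge : Bool → Bool → ℕ → ℕ → K
  charge true  true  a b = share a b
  charge true  false a b = invSqrtProd a b
  charge false _     _ _ = 0K

  module Charging {n : ℕ} (G : Graph n) (M : List (Fin n × Fin n)) where
    open DecMembership (_≟_ {n}) using (_∈?_)

    V : List (Fin n)
    V = allFin n

    matched : Fin n → Bool
    matched u = does (u ∈? endpoints M)

    ∈⇒matched : ∀ {x} → x ∈ endpoints M → matched x ≡ true
    ∈⇒matched {x} = dec-true (x ∈? endpoints M)

    unmatched⇒∉ : ∀ {x} → matched x ≡ false → ¬ x ∈ endpoints M
    unmatched⇒∉ x-unmatched x∈M with trans (sym x-unmatched) (∈⇒matched x∈M)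
    ... | ()

    matched⇒∈ : ∀ {x} → matched x ≡ true → x ∈ endpoints M
    matched⇒∈ {x} x-matched with x ∈? endpoints M
    ... | yes x∈M = x∈M

    d : Fin n → ℕ
    d = deg G

    w : Fin n → Fin n → K
    w u v = invSqrtProd (d u) (d v)

    σ : Fin n → Fin n → K
    σ u v = charge (matched u) (matched v) (d u) (d v)

    received : Fin n → K
    received u = ∑ V (λ v → [ adj G u v ]? σ u v)

    lt : Fin n → Fin n → Bool
    lt u v = toℕ u ℕ.<ᵇ toℕ v

    randic≡∑∑ : randic G ≡ ∑ V (λ u → ∑ V (λ v → [ lt u v ∧ adj G u v ]? w u v))
    randic≡∑∑ = go V
      where
      go : ∀ us → foldr (λ u acc → foldr (λ v acc′ → if lt u v ∧ adj G u v then w u v +K acc′ else acc′) acc V) 0K us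
                ≡ ∑ us (λ u → ∑ V (λ v → [ lt u v ∧ adj G u v ]? w u v))
      go [] = refl
      go (u ∷ us) = trans (foldr-if (λ v → lt u v ∧ adj G u v) (w u) _ V) (cong (∑ V _ +K_) (go us))

    private
      T⇒≡true : ∀ {b} → Bool.T b → b ≡ true
      T⇒≡true {true} _ = refl

      ¬T⇒≡false : ∀ {b} → ¬ Bool.T b → b ≡ false
      ¬T⇒≡false {true} ¬T = ⊥-elim (¬T _)
      ¬T⇒≡false {false} _ = refl

      lt-cases : ∀ u v → u ≢ v → (lt u v ≡ true × lt v u ≡ false) ⊎ (lt u v ≡ false × lt v u ≡ true)
      lt-cases u v u≢v with ℕ.<-cmp (toℕ u) (toℕ v)
      ... | tri< u<v _ _ = inj₁ (T⇒≡true (ℕ.<⇒<ᵇ u<v) , ¬T⇒≡false (λ v<u → ℕ.<-asym u<v (ℕ.<ᵇ⇒< (toℕ v) (toℕ u) v<u)))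
      ... | tri≈ _ u≡v _ = ⊥-elim (u≢v (toℕ-injective u≡v))
      ... | tri> _ _ v<u = inj₂ (¬T⇒≡false (λ u<v → ℕ.<-asym v<u (ℕ.<ᵇ⇒< (toℕ u) (toℕ v) u<v)) , T⇒≡true (ℕ.<⇒<ᵇ v<u))

      ∧-false : ∀ b → b ∧ false ≡ false
      ∧-false true = refl
      ∧-false false = refl

    each-edge-once : ∀ u v x → [ lt u v ∧ adj G u v ]? x +K [ lt v u ∧ adj G v u ]? x ≡ [ adj G u v ]? x
    each-edge-once u v x rewrite adj-sym G v u with adj G u v in uv∈E
    ... | false rewrite ∧-false (lt u v) | ∧-false (lt v u) = +K-identityˡ 0K
    ... | true with lt-cases u v (adj⇒≢ G uv∈E)
    ...   | inj₁ (u<v , v≮u) rewrite u<v | v≮u = +K-identityʳ x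
    ...   | inj₂ (u≮v , v<u) rewrite u≮v | v<u = +K-identityˡ x

    ∑∑-each-edge-once : ∑ V (λ u → ∑ V (λ v → [ lt u v ∧ adj G u v ]? (σ u v +K σ v u))) ≡ ∑ V received
    ∑∑-each-edge-once = begin
      ∑ V (λ u → ∑ V (λ v → [ e u v ]? (σ u v +K σ v u)))
        ≡⟨ ∑-cong V (λ u → trans (∑-cong V (λ v → []?-∙ (e u v) (σ u v) (σ v u))) (∑-distrib V _ _)) ⟩
      ∑ V (λ u → ∑ V (λ v → [ e u v ]? σ u v) +K ∑ V (λ v → [ e u v ]? σ v u))
        ≡⟨ ∑-distrib V _ _ ⟩
      ∑ V (λ u → ∑ V (λ v → [ e u v ]? σ u v)) +K ∑ V (λ u → ∑ V (λ v → [ e u v ]? σ v u))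
        ≡⟨ cong (∑ V (λ u → ∑ V (λ v → [ e u v ]? σ u v)) +K_) (∑-comm V V (λ u v → [ e u v ]? σ v u)) ⟩
      ∑ V (λ u → ∑ V (λ v → [ e u v ]? σ u v)) +K ∑ V (λ u → ∑ V (λ v → [ e v u ]? σ u v))
        ≡⟨ sym (∑-distrib V _ _) ⟩
      ∑ V (λ u → ∑ V (λ v → [ e u v ]? σ u v) +K ∑ V (λ v → [ e v u ]? σ u v))
        ≡⟨ ∑-cong V (λ u → trans (sym (∑-distrib V _ _)) (∑-cong V (λ v → each-edge-once u v (σ u v)))) ⟩
      ∑ V received ∎
      where
      open ≡-Reasoning
      e : Fin n → Fin n → Bool
      e u v = lt u v ∧ adj G u v

    EveryEdgeMatched : Set
    EveryEdgeMatched = ∀ u v → adj G u v ≡ true → matched u ≡ true ⊎ matched v ≡ true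

    module _ (Δ≤3 : MaxDegreeAtMost G 3) (every-edge-matched : EveryEdgeMatched) where

      w≡σ+σ : ∀ {u v} → adj G u v ≡ true → w u v ≡ σ u v +K σ v u
      w≡σ+σ {u} {v} uv∈E = split (matched u) (matched v) (every-edge-matched u v uv∈E)
        where
        du = adj⇒degree1to3 G Δ≤3 uv∈E
        dv = adj⇒degree1to3 G Δ≤3 (trans (adj-sym G v u) uv∈E)
        split : ∀ x y → x ≡ true ⊎ y ≡ true → invSqrtProd (d u) (d v) ≡ charge x y (d u) (d v) +K charge y x (d v) (d u)
        split true true _ = sym (share-sum du dv)
        split true false _ = sym (+K-identityʳ _)
        split false true _ = trans (invSqrtProd-comm du dv) (sym (+K-identityˡ _))
        split false false (inj₁ ())
        split false false (inj₂ ())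

      randic≡∑received : randic G ≡ ∑ V received
      randic≡∑received = begin
        randic G
          ≡⟨ randic≡∑∑ ⟩
        ∑ V (λ u → ∑ V (λ v → [ lt u v ∧ adj G u v ]? w u v))
          ≡⟨ ∑-cong V (λ u → ∑-cong V (λ v → guarded u v)) ⟩
        ∑ V (λ u → ∑ V (λ v → [ lt u v ∧ adj G u v ]? (σ u v +K σ v u)))
          ≡⟨ ∑∑-each-edge-once ⟩
        ∑ V received ∎
        where
        open ≡-Reasoning
        guarded : ∀ u v → [ lt u v ∧ adj G u v ]? w u v ≡ [ lt u v ∧ adj G u v ]? (σ u v +K σ v u)
        guarded u v with lt u v ∧ adj G u v in e
        ... | false = refl
        ... | true = w≡σ+σ (∧-true e)
          where
          ∧-true : ∀ {a b} → a ∧ b ≡ true → b ≡ true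
          ∧-true {true} eq = eq

    ∑-endpoints : ∀ (M′ : List (Fin n × Fin n)) (f : Fin n → K) →
                  ∑ (endpoints M′) f ≡ ∑ M′ (λ e → f (proj₁ e) +K f (proj₂ e))
    ∑-endpoints [] f = refl
    ∑-endpoints ((a , b) ∷ M′) f = trans (cong (λ z → f a +K (f b +K z)) (∑-endpoints M′ f)) (sym (+K-assoc (f a) (f b) _))

    unmatched-receives-nothing : ∀ u → [ not (matched u) ]? received u ≡ 0K
    unmatched-receives-nothing u with matched u
    ... | true = refl
    ... | false = trans (∑-cong V (λ v → []?-ε (adj G u v))) (∑-ε V)

    ∑received≡∑M : Unique (endpoints M) → ∑ V received ≡ ∑ M (λ e → received (proj₁ e) +K received (proj₂ e))
    ∑received≡∑M endpoints-unique = begin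
      ∑ V received
        ≡⟨ ∑-split V matched received ⟩
      ∑ V (λ u → [ matched u ]? received u) +K ∑ V (λ u → [ not (matched u) ]? received u)
        ≡⟨ cong₂ _+K_ (∑-∈? _≟_ V (allFin⁺ n) ∈-allFin (endpoints M) received endpoints-unique)
                      (trans (∑-cong V unmatched-receives-nothing) (∑-ε V)) ⟩
      ∑ (endpoints M) received +K 0K
        ≡⟨ +K-identityʳ _ ⟩
      ∑ (endpoints M) received
        ≡⟨ ∑-endpoints M received ⟩
      ∑ M (λ e → received (proj₁ e) +K received (proj₂ e)) ∎
      where open ≡-Reasoning

    others : Fin n → Fin n → Fin n → Bool
    others a b v = not (does (v ≟ b)) ∧ adj G a v

    received-split : ∀ {a b} → adj G a b ≡ true → received a ≡ σ a b +K ∑ V (λ v → [ others a b v ]? σ a v)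
    received-split {a} {b} ab∈E = begin
      received a
        ≡⟨ ∑-split V (λ v → does (v ≟ b)) (λ v → [ adj G a v ]? σ a v) ⟩
      ∑ V (λ v → [ does (v ≟ b) ]? [ adj G a v ]? σ a v) +K ∑ V (λ v → [ not (does (v ≟ b)) ]? [ adj G a v ]? σ a v)
        ≡⟨ cong₂ _+K_ (trans (∑-point _≟_ V (λ v → [ adj G a v ]? σ a v) (allFin⁺ n) (∈-allFin b)) (cong (λ x → [ x ]? σ a b) ab∈E))
                      (∑-cong V (λ v → []?-∧ (not (does (v ≟ b))) (adj G a v) (σ a v))) ⟩
      σ a b +K ∑ V (λ v → [ others a b v ]? σ a v) ∎
      where open ≡-Reasoning

    deg-split : ∀ {a b} → adj G a b ≡ true → d a ≡ suc (count V (others a b))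
    deg-split {a} {b} ab∈E = begin
      d a
        ≡⟨ deg≡count G a ⟩
      count V (adj G a)
        ≡⟨ ℕ∑.∑-split V (λ v → does (v ≟ b)) (λ v → ℕ∑.[ adj G a v ]? 1) ⟩
      ℕ∑.∑ V (λ v → ℕ∑.[ does (v ≟ b) ]? ℕ∑.[ adj G a v ]? 1) ℕ.+ ℕ∑.∑ V (λ v → ℕ∑.[ not (does (v ≟ b)) ]? ℕ∑.[ adj G a v ]? 1)
        ≡⟨ cong₂ ℕ._+_ (trans (ℕ∑.∑-point _≟_ V (λ v → ℕ∑.[ adj G a v ]? 1) (allFin⁺ n) (∈-allFin b)) (cong (λ x → ℕ∑.[ x ]? 1) ab∈E))
                       (ℕ∑.∑-cong V (λ v → ℕ∑.[]?-∧ (not (does (v ≟ b))) (adj G a v) 1)) ⟩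
      suc (count V (others a b)) ∎
      where open ≡-Reasoning

    others⇒adj : ∀ {a b v} → others a b v ≡ true → adj G a v ≡ true
    others⇒adj {a} {b} {v} eq with does (v ≟ b)
    ... | false = eq

    others⇒≢ : ∀ {a b v} → others a b v ≡ true → v ≢ b
    others⇒≢ {a} {b} {v} av∈others refl rewrite dec-true (v ≟ v) refl with av∈others
    ... | ()

    adj⇒others : ∀ {a b v} → adj G a v ≡ true → v ≢ b → others a b v ≡ true
    adj⇒others {a} {b} {v} av∈E v≢b rewrite dec-false (v ≟ b) v≢b = av∈E

    guaranteed : Fin n → Fin n → K
    guaranteed a b = share (d a) (d b) +K (count V (others a b) ·K minCharge (d a))

    unique-neighbour : ∀ {u x y} → d u ≡ 1 → adj G u x ≡ true → adj G u y ≡ true → y ≡ x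
    unique-neighbour {u} {x} {y} du≡1 ux∈E uy∈E with y ≟ x
    ... | yes y≡x = y≡x
    ... | no y≢x = ⊥-elim (ℕ.<-irrefl refl (subst (1 ℕ.≤_) (ℕ.suc-injective (trans (sym (deg-split ux∈E)) du≡1))
                            (count≥1 V (others u x) (∈-allFin y) (adj⇒others uy∈E y≢x))))

    Good : Fin n → Set
    Good v = matched v ≡ true × d v ≡ 3

    Tight : Fin n → Fin n → Set
    Tight a b = d a ≡ 1 × d b ≡ 3 × (∀ v → adj G b v ≡ true → v ≢ a → Good v)

    module LocalBounds (Δ≤3 : MaxDegreeAtMost G 3) where

      σ-matched : ∀ {a} v → matched a ≡ true → σ a v ≡ charge true (matched v) (d a) (d v)
      σ-matched {a} v a-matched = cong (λ x → charge x (matched v) (d a) (d v)) a-matched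

      minCharge≤σ : ∀ {a b v} → matched a ≡ true → others a b v ≡ true → minCharge (d a) ≤K σ a v
      minCharge≤σ {a} {b} {v} a-matched av∈others =
        subst (minCharge (d a) ≤K_) (sym (σ-matched v a-matched)) (bound (matched v))
        where
        av∈E = others⇒adj {a} {b} {v} av∈others
        da = adj⇒degree1to3 G Δ≤3 av∈E
        dv = adj⇒degree1to3 G Δ≤3 (trans (adj-sym G v a) av∈E)
        bound : ∀ x → minCharge (d a) ≤K charge true x (d a) (d v)
        bound true = minCharge≤share da dv
        bound false = minCharge≤invSqrtProd da dv

      σ-matching-edge : ∀ {a b} → matched a ≡ true → matched b ≡ true → σ a b ≡ share (d a) (d b)
      σ-matching-edge {a} {b} a-matched b-matched = cong₂ (λ x y → charge x y (d a) (d b)) a-matched b-matched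

      guaranteed≤received : ∀ {a b} → adj G a b ≡ true → matched a ≡ true → matched b ≡ true →
                            guaranteed a b ≤K received a
      guaranteed≤received {a} {b} ab∈E a-matched b-matched =
        subst₂ _≤K_ (cong (_+K (count V (others a b) ·K minCharge (d a))) (σ-matching-edge a-matched b-matched)) (sym (received-split ab∈E))
          (+K-mono-≤ {σ a b} {σ a b} {count V (others a b) ·K minCharge (d a)} {∑ V (λ v → [ others a b v ]? σ a v)}
            (≤K-refl {σ a b})
            (∑-≥-count V (others a b) (σ a) (minCharge (d a)) (λ v _ → minCharge≤σ {a} {b} {v} a-matched)))

      guaranteed<received : ∀ {a b} → adj G a b ≡ true → matched a ≡ true → matched b ≡ true →
                            Any (λ v → others a b v ≡ true × minCharge (d a) <K σ a v) V →
                            guaranteed a b <K received a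
      guaranteed<received {a} {b} ab∈E a-matched b-matched strict =
        subst₂ _<K_ (cong (_+K (count V (others a b) ·K minCharge (d a))) (σ-matching-edge a-matched b-matched)) (sym (received-split ab∈E))
          (+K-mono-≤-< {σ a b} {σ a b} {count V (others a b) ·K minCharge (d a)} {∑ V (λ v → [ others a b v ]? σ a v)}
            (≤K-refl {σ a b})
            (∑->-count V (others a b) (σ a) (minCharge (d a)) (λ v _ → minCharge≤σ {a} {b} {v} a-matched) strict))

      degree-of-edge : ∀ {a b} → adj G a b ≡ true → Degree1to3 (suc (count V (others a b)))
      degree-of-edge ab∈E = subst Degree1to3 (deg-split ab∈E) (adj⇒degree1to3 G Δ≤3 ab∈E)

      edgeBound≡guaranteed : ∀ {a b} → adj G a b ≡ true →
        edgeBound (count V (others a b)) (count V (others b a)) ≡ (guaranteed a b +K guaranteed b a)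
      edgeBound≡guaranteed {a} {b} ab∈E =
        cong₂ (λ x y → (share x y +K (i ·K minCharge x)) +K (share y x +K (j ·K minCharge y)))
              (sym (deg-split ab∈E)) (sym (deg-split (trans (adj-sym G b a) ab∈E)))
        where
        i = count V (others a b)
        j = count V (others b a)

      guaranteed≤received₂ : ∀ {a b} → adj G a b ≡ true → matched a ≡ true → matched b ≡ true →
                             (guaranteed a b +K guaranteed b a) ≤K (received a +K received b)
      guaranteed≤received₂ {a} {b} ab∈E a-matched b-matched =
        +K-mono-≤ {guaranteed a b} {received a} {guaranteed b a} {received b}
          (guaranteed≤received ab∈E a-matched b-matched)
          (guaranteed≤received (trans (adj-sym G b a) ab∈E) b-matched a-matched)

      c₃≤received : ∀ {a b} → adj G a b ≡ true → matched a ≡ true → matched b ≡ true →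
                    c₃ ≤K (received a +K received b)
      c₃≤received {a} {b} ab∈E a-matched b-matched = begin
        c₃                                   ≲⟨ edgeBound-≥c₃ (degree-of-edge ab∈E) (degree-of-edge (trans (adj-sym G b a) ab∈E)) ⟩
        edgeBound (count V (others a b)) (count V (others b a))
                                             ≡⟨ edgeBound≡guaranteed ab∈E ⟩
        guaranteed a b +K guaranteed b a     ≲⟨ guaranteed≤received₂ ab∈E a-matched b-matched ⟩
        received a +K received b             ∎
        where open Relation.Binary.Reasoning.Preorder ≤K-preorder

      received≡guaranteed : ∀ {a b} → adj G a b ≡ true → matched a ≡ true → matched b ≡ true →
                            (∀ v → others a b v ≡ true → σ a v ≡ minCharge (d a)) → received a ≡ guaranteed a b
      received≡guaranteed {a} {b} ab∈E a-matched b-matched exact = begin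
        received a
          ≡⟨ received-split ab∈E ⟩
        σ a b +K ∑ V (λ v → [ others a b v ]? σ a v)
          ≡⟨ cong₂ _+K_ (σ-matching-edge a-matched b-matched) (∑-exact V (others a b) (σ a) (minCharge (d a)) exact) ⟩
        guaranteed a b ∎
        where open ≡-Reasoning

      good? : ∀ v → Dec (Good v)
      good? v = (matched v Bool.≟ true) ×-dec (d v ℕ.≟ 3)

      minCharge₃<σ : ∀ {b v} → matched b ≡ true → d b ≡ 3 → adj G b v ≡ true → ¬ Good v → minCharge 3 <K σ b v
      minCharge₃<σ {b} {v} b-matched db≡3 bv∈E ¬good
        rewrite σ-matched v b-matched | db≡3 with matched v
      ... | true = minCharge₃<share dv (λ dv≡3 → ¬good (refl , dv≡3))
        where dv = adj⇒degree1to3 G Δ≤3 (trans (adj-sym G v b) bv∈E)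
      ... | false = minCharge₃<invSqrtProd (adj⇒degree1to3 G Δ≤3 (trans (adj-sym G v b) bv∈E))

      pendant-tight-or-strict : ∀ {a b} → adj G a b ≡ true → matched a ≡ true → matched b ≡ true →
        count V (others a b) ≡ 0 → count V (others b a) ≡ 2 → Tight a b ⊎ c₃ <K (received a +K received b)
      pendant-tight-or-strict {a} {b} ab∈E a-matched b-matched i≡0 j≡2 = by-cases (any? deviant? V)
        where
        ba∈E = trans (adj-sym G b a) ab∈E
        db≡3 = trans (deg-split ba∈E) (cong suc j≡2)

        deviant? : ∀ v → Dec (others b a v ≡ true × ¬ Good v)
        deviant? v = (others b a v Bool.≟ true) ×-dec ¬? (good? v)

        strict : ∀ {v} → others b a v ≡ true → ¬ Good v → c₃ <K (received a +K received b)
        strict {v} bv∈others ¬good = subst (_<K (received a +K received b)) c₃≡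
          (+K-mono-≤-< {guaranteed a b} {received a} {guaranteed b a} {received b}
            (guaranteed≤received ab∈E a-matched b-matched)
            (guaranteed<received ba∈E b-matched a-matched (lose (∈-allFin v) (bv∈others , σ-strict))))
          where
          σ-strict : minCharge (d b) <K σ b v
          σ-strict = subst (λ x → minCharge x <K σ b v) (sym db≡3)
            (minCharge₃<σ b-matched db≡3 (others⇒adj {b} {a} {v} bv∈others) ¬good)
          c₃≡ : (guaranteed a b +K guaranteed b a) ≡ c₃
          c₃≡ = trans (sym (edgeBound≡guaranteed ab∈E)) (cong₂ edgeBound i≡0 j≡2)

        by-cases : Dec (Any (λ v → others b a v ≡ true × ¬ Good v) V) → Tight a b ⊎ c₃ <K (received a +K received b)
        by-cases (yes deviant) = let (v , bv∈others , ¬good) = satisfied deviant in inj₂ (strict bv∈others ¬good)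
        by-cases (no ¬deviant) = inj₁ (trans (deg-split ab∈E) (cong suc i≡0) , db≡3 , λ v bv∈E v≢a →
          decidable-stable (good? v) (λ ¬good → ¬deviant (lose (∈-allFin v) (adj⇒others bv∈E v≢a , ¬good))))

      tight-or-strict : ∀ {a b} → adj G a b ≡ true → matched a ≡ true → matched b ≡ true →
                        (Tight a b ⊎ Tight b a) ⊎ c₃ <K (received a +K received b)
      tight-or-strict {a} {b} ab∈E a-matched b-matched =
        by-cases (edgeBound->c₃ (degree-of-edge ab∈E) (degree-of-edge ba∈E))
        where
        ba∈E = trans (adj-sym G b a) ab∈E
        i = count V (others a b)
        j = count V (others b a)

        by-cases : (i ≡ 0 × j ≡ 2) ⊎ (i ≡ 2 × j ≡ 0) ⊎ c₃ <K edgeBound i j →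
                   (Tight a b ⊎ Tight b a) ⊎ c₃ <K (received a +K received b)
        by-cases (inj₁ (i≡0 , j≡2)) = Sum.map₁ inj₁ (pendant-tight-or-strict ab∈E a-matched b-matched i≡0 j≡2)
        by-cases (inj₂ (inj₁ (i≡2 , j≡0))) = Sum.map inj₂ (subst (c₃ <K_) (+K-comm (received b) (received a)))
          (pendant-tight-or-strict ba∈E b-matched a-matched j≡0 i≡2)
        by-cases (inj₂ (inj₂ c₃<edgeBound)) = inj₂ (<K-≤K-trans {c₃} {guaranteed a b +K guaranteed b a} {received a +K received b}
          (subst (c₃ <K_) (edgeBound≡guaranteed ab∈E) c₃<edgeBound) (guaranteed≤received₂ ab∈E a-matched b-matched))

module MaximumMatchings where

  open import Data.Bool using (true; false)
  open import Data.Empty using (⊥-elim)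
  open import Data.Fin using (Fin)
  open import Data.List using (List; _∷_; length)
  open import Data.List.Membership.Propositional using (_∈_; lose)
  open import Data.List.Relation.Unary.All as All using (_∷_)
  open import Data.List.Relation.Unary.All.Properties using (¬Any⇒All¬)
  open import Data.List.Relation.Unary.AllPairs using (_∷_)
  open import Data.List.Relation.Unary.Any using (here; there)
  open import Data.Nat as ℕ using (ℕ; _≤_)
  import Data.Nat.Properties as ℕ
  open import Data.Product using (_×_; _,_; proj₁; proj₂)
  open import Data.Sum as Sum using (_⊎_; inj₁; inj₂)
  open import Function using (id)
  open import Relation.Binary.PropositionalEquality

  open OrderOnK
  open ListSums
  open ChargeTable
  open Discharging

  open ListSum +K-isCommutativeMonoid

  module _ {n : ℕ} (G : Graph n) (M : List (Fin n × Fin n)) where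
    open Charging G M

    maximum⇒everyEdgeMatched : IsMatching G M → (∀ M′ → IsMatching G M′ → length M′ ≤ length M) → EveryEdgeMatched
    maximum⇒everyEdgeMatched (edges , endpoints-unique) maximum u v uv∈E with matched u in u-matched | matched v in v-matched
    ... | true | _ = inj₁ refl
    ... | false | true = inj₂ refl
    ... | false | false = ⊥-elim (ℕ.1+n≰n (maximum ((u , v) ∷ M) (uv∈E ∷ edges , (adj⇒≢ G uv∈E ∷ fresh u-matched) ∷ fresh v-matched ∷ endpoints-unique)))
      where
      fresh : ∀ {x} → matched x ≡ false → All.All (x ≢_) (endpoints M)
      fresh x-unmatched = ¬Any⇒All¬ (endpoints M) (unmatched⇒∉ x-unmatched)

    endpoints-∈ : ∀ {a b} (M′ : List (Fin n × Fin n)) → (a , b) ∈ M′ → a ∈ endpoints M′ × b ∈ endpoints M′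
    endpoints-∈ (_ ∷ M′) (here refl) = here refl , there (here refl)
    endpoints-∈ (_ ∷ M′) (there ab∈M′) with endpoints-∈ M′ ab∈M′
    ... | a∈ , b∈ = there (there a∈) , there (there b∈)

    module MatchingBound (Δ≤3 : MaxDegreeAtMost G 3) (isMatching : IsMatching G M) (every-edge-matched : EveryEdgeMatched) where
      open LocalBounds Δ≤3

      edgeTotal : Fin n × Fin n → K
      edgeTotal (a , b) = received a +K received b

      randic≡∑edgeTotal : randic G ≡ ∑ M edgeTotal
      randic≡∑edgeTotal = trans (randic≡∑received Δ≤3 every-edge-matched) (∑received≡∑M (proj₂ isMatching))

      private
        matching-edge : ∀ {a b} → (a , b) ∈ M → adj G a b ≡ true × matched a ≡ true × matched b ≡ true
        matching-edge ab∈M = All.lookup (proj₁ isMatching) ab∈M ,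
                             ∈⇒matched (proj₁ (endpoints-∈ M ab∈M)) , ∈⇒matched (proj₂ (endpoints-∈ M ab∈M))

        c₃≤edgeTotal : ∀ e → e ∈ M → c₃ ≤K edgeTotal e
        c₃≤edgeTotal (a , b) ab∈M = let (ab∈E , a-matched , b-matched) = matching-edge ab∈M in
          c₃≤received ab∈E a-matched b-matched

      length·c₃≤randic : (length M ·K c₃) ≤K randic G
      length·c₃≤randic = subst₂ _≤K_ (cong (_·K c₃) (count-true≡length M)) (sym randic≡∑edgeTotal)
        (∑-≥-count M (λ _ → true) edgeTotal c₃ (λ e e∈M _ → c₃≤edgeTotal e e∈M))

      length·c₃<randic : ∀ {e} → e ∈ M → c₃ <K edgeTotal e → (length M ·K c₃) <K randic G
      length·c₃<randic e∈M c₃<edgeTotal = subst₂ _<K_ (cong (_·K c₃) (count-true≡length M)) (sym randic≡∑edgeTotal)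
        (∑->-count M (λ _ → true) edgeTotal c₃ (λ e e∈M _ → c₃≤edgeTotal e e∈M) (lose e∈M (refl , c₃<edgeTotal)))

      randic≡length·c₃⇒tight : randic G ≡ (length M ·K c₃) → ∀ {a b} → (a , b) ∈ M → Tight a b ⊎ Tight b a
      randic≡length·c₃⇒tight randic≡ {a} {b} ab∈M =
        let (ab∈E , a-matched , b-matched) = matching-edge ab∈M in
        Sum.[ id , (λ c₃<edgeTotal → ⊥-elim (proj₂ (length·c₃<randic ab∈M c₃<edgeTotal) (≤K-reflexive {randic G} randic≡))) ]′
          (tight-or-strict ab∈E a-matched b-matched)

module Coronas where

  open import Data.Bool using (Bool; true; false; not)
  open import Data.Empty using (⊥-elim)
  open import Data.Fin as Fin using (Fin)
  open import Data.Fin.Properties using (_≟_)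
  open import Data.List using (List; []; _∷_; length; lookup; allFin; map)
  open import Data.List.Properties using (length-map; length-tabulate)
  open import Data.List.Membership.Propositional using (_∈_)
  open import Data.List.Membership.Propositional.Properties using (∈-allFin; ∈-lookup; ∈-map⁺; ∈-map⁻)
  import Data.List.Membership.DecPropositional as DecMembership
  open import Data.List.Relation.Unary.All as All using (All; _∷_)
  open import Data.List.Relation.Unary.AllPairs using ([]; _∷_)
  open import Data.List.Relation.Unary.Any using (here; there)
  open import Data.List.Relation.Unary.Unique.Propositional using (Unique)
  open import Data.List.Relation.Unary.Unique.Propositional.Properties using (allFin⁺) renaming (map⁺ to Unique-map⁺)
  open import Data.Nat as ℕ using (ℕ; zero; suc)
  import Data.Nat.Properties as ℕ
  open import Data.Nat.Solver using (module +-*-Solver)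
  open import Data.Product using (∃; _×_; _,_; proj₁; proj₂)
  open import Data.Sum using (_⊎_; inj₁; inj₂)
  open import Function using (id)
  open import Function.Definitions using (Injective)
  open import Relation.Binary.PropositionalEquality
  open import Relation.Nullary using (does; yes; no)
  open import Relation.Nullary.Decidable using (⌊_⌋; dec-true; dec-false)

  open OrderOnK
  open ListSums
  open ChargeTable
  open Discharging
  open MaximumMatchings

  open ListSum +K-isCommutativeMonoid using (∑; ∑-map; ∑-cong)

  module _ {n : ℕ} where

    _∈ₑ_ : Fin n → Fin n × Fin n → Set
    x ∈ₑ (a , b) = x ≡ a ⊎ x ≡ b

    ∈ₑ-lookup⇒∈endpoints : ∀ (L : List (Fin n × Fin n)) (i : Fin (length L)) {x} → x ∈ₑ lookup L i → x ∈ endpoints L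
    ∈ₑ-lookup⇒∈endpoints (_ ∷ L) Fin.zero (inj₁ refl) = here refl
    ∈ₑ-lookup⇒∈endpoints (_ ∷ L) Fin.zero (inj₂ refl) = there (here refl)
    ∈ₑ-lookup⇒∈endpoints (_ ∷ L) (Fin.suc i) x∈ₑ = there (there (∈ₑ-lookup⇒∈endpoints L i x∈ₑ))

    ∈endpoints⇒∈ₑ-lookup : ∀ (L : List (Fin n × Fin n)) {x} → x ∈ endpoints L → ∃ λ i → x ∈ₑ lookup L i
    ∈endpoints⇒∈ₑ-lookup (_ ∷ L) (here refl) = Fin.zero , inj₁ refl
    ∈endpoints⇒∈ₑ-lookup (_ ∷ L) (there (here refl)) = Fin.zero , inj₂ refl
    ∈endpoints⇒∈ₑ-lookup (_ ∷ L) (there (there x∈)) with ∈endpoints⇒∈ₑ-lookup L x∈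
    ... | i , x∈ₑ = Fin.suc i , x∈ₑ

    ∈ₑ-unique : ∀ (L : List (Fin n × Fin n)) → Unique (endpoints L) → ∀ {i j x} →
                x ∈ₑ lookup L i → x ∈ₑ lookup L j → i ≡ j
    ∈ₑ-unique (_ ∷ L) _ {Fin.zero} {Fin.zero} _ _ = refl
    ∈ₑ-unique (_ ∷ L) ((_ ∷ a∉) ∷ (b∉ ∷ _)) {Fin.zero} {Fin.suc j} (inj₁ refl) x∈ₑj = ⊥-elim (All.lookup a∉ (∈ₑ-lookup⇒∈endpoints L j x∈ₑj) refl)
    ∈ₑ-unique (_ ∷ L) ((_ ∷ a∉) ∷ (b∉ ∷ _)) {Fin.zero} {Fin.suc j} (inj₂ refl) x∈ₑj = ⊥-elim (All.lookup b∉ (∈ₑ-lookup⇒∈endpoints L j x∈ₑj) refl)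
    ∈ₑ-unique (_ ∷ L) ((_ ∷ a∉) ∷ (b∉ ∷ _)) {Fin.suc i} {Fin.zero} x∈ₑi (inj₁ refl) = ⊥-elim (All.lookup a∉ (∈ₑ-lookup⇒∈endpoints L i x∈ₑi) refl)
    ∈ₑ-unique (_ ∷ L) ((_ ∷ a∉) ∷ (b∉ ∷ _)) {Fin.suc i} {Fin.zero} x∈ₑi (inj₂ refl) = ⊥-elim (All.lookup b∉ (∈ₑ-lookup⇒∈endpoints L i x∈ₑi) refl)
    ∈ₑ-unique (_ ∷ L) (_ ∷ (_ ∷ unique)) {Fin.suc i} {Fin.suc j} x∈ₑi x∈ₑj = cong Fin.suc (∈ₑ-unique L unique x∈ₑi x∈ₑj)

  module TightMatching {n : ℕ} (G : Graph n) (M : List (Fin n × Fin n)) (isMatching : IsMatching G M)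
    (every-edge-matched : Charging.EveryEdgeMatched G M)
    (tight : ∀ {a b} → (a , b) ∈ M → Charging.Tight G M a b ⊎ Charging.Tight G M b a) where
    open Charging G M

    record Orientation (e : Fin n × Fin n) : Set where
      field
        centre leaf : Fin n
        tight-edge : Tight leaf centre
        centre-leaf∈E : adj G centre leaf ≡ true
        centre∈ₑ : centre ∈ₑ e
        leaf∈ₑ : leaf ∈ₑ e
        centre-or-leaf : ∀ {x} → x ∈ₑ e → x ≡ centre ⊎ x ≡ leaf

    orient : ∀ {a b} → (a , b) ∈ M → Orientation (a , b)
    orient {a} {b} ab∈M with tight ab∈M
    ... | inj₁ tight-ab = record
      { centre = b ; leaf = a ; tight-edge = tight-ab ; centre-leaf∈E = trans (adj-sym G b a) ab∈E
      ; centre∈ₑ = inj₂ refl ; leaf∈ₑ = inj₁ refl ; centre-or-leaf = λ { (inj₁ x≡a) → inj₂ x≡a ; (inj₂ x≡b) → inj₁ x≡b } }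
      where ab∈E = All.lookup (proj₁ isMatching) ab∈M
    ... | inj₂ tight-ba = record
      { centre = a ; leaf = b ; tight-edge = tight-ba ; centre-leaf∈E = All.lookup (proj₁ isMatching) ab∈M
      ; centre∈ₑ = inj₁ refl ; leaf∈ₑ = inj₂ refl ; centre-or-leaf = λ x∈ₑ → x∈ₑ }

    m : ℕ
    m = length M

    orientation : ∀ (i : Fin m) → Orientation (lookup M i)
    orientation i = orient (∈-lookup i)

    centre leaf : Fin m → Fin n
    centre i = Orientation.centre (orientation i)
    leaf i = Orientation.leaf (orientation i)

    deg-leaf : ∀ i → d (leaf i) ≡ 1
    deg-leaf i = proj₁ (Orientation.tight-edge (orientation i))

    deg-centre : ∀ i → d (centre i) ≡ 3
    deg-centre i = proj₁ (proj₂ (Orientation.tight-edge (orientation i)))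

    centre-leaf∈E : ∀ i → adj G (centre i) (leaf i) ≡ true
    centre-leaf∈E i = Orientation.centre-leaf∈E (orientation i)

    centre≢leaf : ∀ i j → centre i ≢ leaf j
    centre≢leaf i j centre≡leaf with trans (sym (deg-centre i)) (trans (cong d centre≡leaf) (deg-leaf j))
    ... | ()

    centre-injective : ∀ {i j} → centre i ≡ centre j → i ≡ j
    centre-injective {i} {j} centre≡ = ∈ₑ-unique M (proj₂ isMatching)
      (Orientation.centre∈ₑ (orientation i)) (subst (_∈ₑ lookup M j) (sym centre≡) (Orientation.centre∈ₑ (orientation j)))

    leaf-injective : ∀ {i j} → leaf i ≡ leaf j → i ≡ j
    leaf-injective {i} {j} leaf≡ = ∈ₑ-unique M (proj₂ isMatching)
      (Orientation.leaf∈ₑ (orientation i)) (subst (_∈ₑ lookup M j) (sym leaf≡) (Orientation.leaf∈ₑ (orientation j)))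

    matched⇒centre-or-leaf : ∀ {x} → matched x ≡ true → ∃ λ j → x ≡ centre j ⊎ x ≡ leaf j
    matched⇒centre-or-leaf x-matched with ∈endpoints⇒∈ₑ-lookup M (matched⇒∈ x-matched)
    ... | j , x∈ₑ = j , Orientation.centre-or-leaf (orientation j) x∈ₑ

    centre-matched : ∀ i → matched (centre i) ≡ true
    centre-matched i = ∈⇒matched (∈ₑ-lookup⇒∈endpoints M i (Orientation.centre∈ₑ (orientation i)))

    leaf-matched : ∀ i → matched (leaf i) ≡ true
    leaf-matched i = ∈⇒matched (∈ₑ-lookup⇒∈endpoints M i (Orientation.leaf∈ₑ (orientation i)))

    good⇒centre : ∀ {x} → Good x → ∃ λ j → x ≡ centre j
    good⇒centre {x} (x-matched , dx≡3) with matched⇒centre-or-leaf x-matched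
    ... | j , inj₁ x≡centre = j , x≡centre
    ... | j , inj₂ x≡leaf with trans (sym dx≡3) (trans (cong d x≡leaf) (deg-leaf j))
    ...   | ()

    leaf-neighbour : ∀ {i y} → adj G (leaf i) y ≡ true → y ≡ centre i
    leaf-neighbour {i} leaf-y∈E = unique-neighbour (deg-leaf i) (trans (adj-sym G (leaf i) (centre i)) (centre-leaf∈E i)) leaf-y∈E

    H : Graph m
    H = record
      { adj = λ i j → adj G (centre i) (centre j)
      ; adj-sym = λ i j → adj-sym G (centre i) (centre j)
      ; adj-irr = λ i → adj-irr G (centre i) }

    private
      open DecMembership (_≟_ {n}) using (_∈?_)

      centres : List (Fin n)
      centres = map centre (allFin m)

      isCentre : Fin n → Bool
      isCentre x = does (x ∈? centres)

      centres-unique : Unique centres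
      centres-unique = Unique-map⁺ centre-injective (allFin⁺ m)

      leaf-not-centre : ∀ i → isCentre (leaf i) ≡ false
      leaf-not-centre i = dec-false (leaf i ∈? centres) λ leaf∈centres →
        let (j , _ , leaf≡centre) = ∈-map⁻ centre leaf∈centres in centre≢leaf j i (sym leaf≡centre)

      -- the only neighbour of a centre that is not itself a centre is its leaf
      non-centre-neighbour : ∀ i x → ℕ∑.[ not (isCentre x) ]? ℕ∑.[ adj G (centre i) x ]? 1 ≡ ℕ∑.[ does (x ≟ leaf i) ]? 1
      non-centre-neighbour i x with x ≟ leaf i
      ... | yes refl rewrite leaf-not-centre i | centre-leaf∈E i = refl
      ... | no x≢leaf with adj G (centre i) x in centre-x∈E
      ...   | false = ℕ∑.[]?-ε (not (isCentre x))
      ...   | true with good⇒centre (proj₂ (proj₂ (Orientation.tight-edge (orientation i))) x centre-x∈E x≢leaf)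
      ...     | j , refl rewrite dec-true (centre j ∈? centres) (∈-map⁺ centre (∈-allFin j)) = refl

    H-2-regular : Regular H 2
    H-2-regular i = ℕ.suc-injective (trans (sym split) (deg-centre i))
      where
      open ≡-Reasoning
      degH : deg H i ≡ ℕ∑.∑ V (λ x → ℕ∑.[ isCentre x ]? ℕ∑.[ adj G (centre i) x ]? 1)
      degH = begin
        deg H i
          ≡⟨ deg≡count H i ⟩
        count (allFin m) (λ j → adj G (centre i) (centre j))
          ≡⟨ sym (ℕ∑.∑-map centre (allFin m) (λ x → ℕ∑.[ adj G (centre i) x ]? 1)) ⟩
        ℕ∑.∑ centres (λ x → ℕ∑.[ adj G (centre i) x ]? 1)
          ≡⟨ sym (ℕ∑.∑-∈? _≟_ V (allFin⁺ n) ∈-allFin centres _ centres-unique) ⟩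
        ℕ∑.∑ V (λ x → ℕ∑.[ isCentre x ]? ℕ∑.[ adj G (centre i) x ]? 1) ∎
      split : d (centre i) ≡ 1 ℕ.+ deg H i
      split = begin
        d (centre i)
          ≡⟨ deg≡count G (centre i) ⟩
        count V (adj G (centre i))
          ≡⟨ ℕ∑.∑-split V isCentre (λ x → ℕ∑.[ adj G (centre i) x ]? 1) ⟩
        ℕ∑.∑ V (λ x → ℕ∑.[ isCentre x ]? ℕ∑.[ adj G (centre i) x ]? 1) ℕ.+ ℕ∑.∑ V (λ x → ℕ∑.[ not (isCentre x) ]? ℕ∑.[ adj G (centre i) x ]? 1)
          ≡⟨ cong₂ ℕ._+_ (sym degH) (trans (ℕ∑.∑-cong V (non-centre-neighbour i)) (ℕ∑.∑-point _≟_ V (λ _ → 1) (allFin⁺ n) (∈-allFin (leaf i)))) ⟩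
        deg H i ℕ.+ 1
          ≡⟨ ℕ.+-comm (deg H i) 1 ⟩
        1 ℕ.+ deg H i ∎

    nonisolated⇒matched : ∀ v → d v ≢ 0 → matched v ≡ true
    nonisolated⇒matched v dv≢0 with count≢0⇒∃ V (adj G v) (λ count≡0 → dv≢0 (trans (deg≡count G v) count≡0))
    ... | u , vu∈E with every-edge-matched v u vu∈E
    ...   | inj₁ v-matched = v-matched
    ...   | inj₂ u-matched with matched⇒centre-or-leaf u-matched
    ...     | j , inj₂ refl = subst (λ x → matched x ≡ true) (sym (leaf-neighbour (trans (adj-sym G (leaf j) v) vu∈E))) (centre-matched j)
    ...     | j , inj₁ refl with v ≟ leaf j
    ...       | yes refl = leaf-matched j
    ...       | no v≢leaf = proj₁ (proj₂ (proj₂ (Orientation.tight-edge (orientation j))) v (trans (adj-sym G (centre j) v) vu∈E) v≢leaf)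

    f : Fin m ⊎ Fin m → Fin n
    f (inj₁ i) = centre i
    f (inj₂ i) = leaf i

    f-injective : Injective _≡_ _≡_ f
    f-injective {inj₁ i} {inj₁ j} eq = cong inj₁ (centre-injective eq)
    f-injective {inj₁ i} {inj₂ j} eq = ⊥-elim (centre≢leaf i j eq)
    f-injective {inj₂ i} {inj₁ j} eq = ⊥-elim (centre≢leaf j i (sym eq))
    f-injective {inj₂ i} {inj₂ j} eq = cong inj₂ (leaf-injective eq)

    f-nonisolated : ∀ a → d (f a) ≢ 0
    f-nonisolated (inj₁ i) d≡0 with trans (sym (deg-centre i)) d≡0
    ... | ()
    f-nonisolated (inj₂ i) d≡0 with trans (sym (deg-leaf i)) d≡0
    ... | ()

    f-onto-nonisolated : ∀ v → d v ≢ 0 → ∃ λ a → f a ≡ v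
    f-onto-nonisolated v dv≢0 with matched⇒centre-or-leaf (nonisolated⇒matched v dv≢0)
    ... | j , inj₁ v≡centre = inj₁ j , sym v≡centre
    ... | j , inj₂ v≡leaf = inj₂ j , sym v≡leaf

    private
      centre-leaf∉E : ∀ {i j} → i ≢ j → adj G (centre i) (leaf j) ≡ false
      centre-leaf∉E {i} {j} i≢j with adj G (centre i) (leaf j) in ci-lj∈E
      ... | false = refl
      ... | true = ⊥-elim (i≢j (centre-injective (leaf-neighbour (trans (adj-sym G (leaf j) (centre i)) ci-lj∈E))))

      leaf-leaf∉E : ∀ i j → adj G (leaf i) (leaf j) ≡ false
      leaf-leaf∉E i j with adj G (leaf i) (leaf j) in li-lj∈E
      ... | false = refl
      ... | true = ⊥-elim (centre≢leaf i j (sym (leaf-neighbour li-lj∈E)))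

    f-adj : ∀ a b → adj G (f a) (f b) ≡ coronaAdj H a b
    f-adj (inj₁ i) (inj₁ j) = refl
    f-adj (inj₁ i) (inj₂ j) with i ≟ j
    ... | yes refl = centre-leaf∈E i
    ... | no i≢j = centre-leaf∉E i≢j
    f-adj (inj₂ i) (inj₁ j) with i ≟ j
    ... | yes refl = trans (adj-sym G (leaf i) (centre i)) (centre-leaf∈E i)
    ... | no i≢j = trans (adj-sym G (leaf i) (centre j)) (centre-leaf∉E (λ j≡i → i≢j (sym j≡i)))
    f-adj (inj₂ i) (inj₂ j) = leaf-leaf∉E i j

    isCorona : NonIsolatedPartIsCoronaOf2Regular G
    isCorona = m , H , H-2-regular , f , f-injective , f-nonisolated , f-onto-nonisolated , f-adj

  interleave : ∀ {m} → List (Fin m) → List (Fin m ⊎ Fin m)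
  interleave [] = []
  interleave (i ∷ is) = inj₁ i ∷ inj₂ i ∷ interleave is

  module _ {m : ℕ} where

    private
      ∈-interleave⁻ : ∀ (is : List (Fin m)) {a} → a ∈ interleave is → ∃ λ i → i ∈ is × (a ≡ inj₁ i ⊎ a ≡ inj₂ i)
      ∈-interleave⁻ (i ∷ is) (here refl) = i , here refl , inj₁ refl
      ∈-interleave⁻ (i ∷ is) (there (here refl)) = i , here refl , inj₂ refl
      ∈-interleave⁻ (i ∷ is) (there (there a∈)) with ∈-interleave⁻ is a∈
      ... | j , j∈is , a≡ = j , there j∈is , a≡

    interleave-unique : ∀ (is : List (Fin m)) → Unique is → Unique (interleave is)
    interleave-unique [] [] = []
    interleave-unique (i ∷ is) (i∉is ∷ is-unique) =
      ((λ ()) ∷ All.tabulate (λ a∈ → inj₁-fresh (∈-interleave⁻ is a∈))) ∷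
      All.tabulate (λ a∈ → inj₂-fresh (∈-interleave⁻ is a∈)) ∷ interleave-unique is is-unique
      where
      inj₁-fresh : ∀ {a} → (∃ λ j → j ∈ is × (a ≡ inj₁ j ⊎ a ≡ inj₂ j)) → inj₁ i ≢ a
      inj₁-fresh (j , j∈is , inj₁ refl) refl = All.lookup i∉is j∈is refl
      inj₁-fresh (j , j∈is , inj₂ refl) ()
      inj₂-fresh : ∀ {a} → (∃ λ j → j ∈ is × (a ≡ inj₁ j ⊎ a ≡ inj₂ j)) → inj₂ i ≢ a
      inj₂-fresh (j , j∈is , inj₁ refl) ()
      inj₂-fresh (j , j∈is , inj₂ refl) refl = All.lookup i∉is j∈is refl

    ∈-interleave : ∀ {is : List (Fin m)} {i} → i ∈ is → inj₁ i ∈ interleave is × inj₂ i ∈ interleave is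
    ∈-interleave {_ ∷ is} (here refl) = here refl , there (here refl)
    ∈-interleave {_ ∷ is} (there i∈is) with ∈-interleave i∈is
    ... | l , r = there (there l) , there (there r)

    ∈-interleave-allFin : ∀ a → a ∈ interleave (allFin m)
    ∈-interleave-allFin (inj₁ i) = proj₁ (∈-interleave (∈-allFin i))
    ∈-interleave-allFin (inj₂ i) = proj₂ (∈-interleave (∈-allFin i))

    ∑-interleave : ∀ (is : List (Fin m)) (h : Fin m ⊎ Fin m → ℕ) →
                   ℕ∑.∑ (interleave is) h ≡ ℕ∑.∑ is (λ i → h (inj₁ i)) ℕ.+ ℕ∑.∑ is (λ i → h (inj₂ i))
    ∑-interleave [] h = refl
    ∑-interleave (i ∷ is) h = begin
      h (inj₁ i) ℕ.+ (h (inj₂ i) ℕ.+ ℕ∑.∑ (interleave is) h)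
        ≡⟨ cong (λ z → h (inj₁ i) ℕ.+ (h (inj₂ i) ℕ.+ z)) (∑-interleave is h) ⟩
      h (inj₁ i) ℕ.+ (h (inj₂ i) ℕ.+ (ℕ∑.∑ is (λ i → h (inj₁ i)) ℕ.+ ℕ∑.∑ is (λ i → h (inj₂ i))))
        ≡⟨ solve 4 (λ a b x y → a :+ (b :+ (x :+ y)) := (a :+ x) :+ (b :+ y)) refl (h (inj₁ i)) (h (inj₂ i)) _ _ ⟩
      (h (inj₁ i) ℕ.+ ℕ∑.∑ is (λ i → h (inj₁ i))) ℕ.+ (h (inj₂ i) ℕ.+ ℕ∑.∑ is (λ i → h (inj₂ i))) ∎
      where
      open ≡-Reasoning
      open +-*-Solver

  module CoronaRandic {n : ℕ} (G : Graph n) (Δ≤3 : MaxDegreeAtMost G 3) (m : ℕ) (H : Graph m) (H-2-regular : Regular H 2)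
    (f : Fin m ⊎ Fin m → Fin n) (f-injective : Injective _≡_ _≡_ f)
    (f-onto : ∀ v → deg G v ≢ 0 → ∃ λ a → f a ≡ v) (f-adj : ∀ a b → adj G (f a) (f b) ≡ coronaAdj H a b) where

    centre leaf : Fin m → Fin n
    centre i = f (inj₁ i)
    leaf i = f (inj₂ i)

    M : List (Fin n × Fin n)
    M = map (λ i → centre i , leaf i) (allFin m)

    open Charging G M
    open LocalBounds Δ≤3
    open DecMembership (_≟_ {n}) using (_∈?_)

    private
      domain : List (Fin m ⊎ Fin m)
      domain = interleave (allFin m)

      image : List (Fin n)
      image = map f domain

      image-unique : Unique image
      image-unique = Unique-map⁺ f-injective (interleave-unique (allFin m) (allFin⁺ m))

      endpoints≡image : ∀ is → endpoints (map (λ i → centre i , leaf i) is) ≡ map f (interleave is)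
      endpoints≡image [] = refl
      endpoints≡image (i ∷ is) = cong (λ z → centre i ∷ leaf i ∷ z) (endpoints≡image is)

      i≟i : ∀ (i : Fin m) → ⌊ i ≟ i ⌋ ≡ true
      i≟i i with i ≟ i
      ... | yes _ = refl
      ... | no i≢i = ⊥-elim (i≢i refl)

    centre-leaf∈E : ∀ i → adj G (centre i) (leaf i) ≡ true
    centre-leaf∈E i = trans (f-adj (inj₁ i) (inj₂ i)) (i≟i i)

    isMatching : IsMatching G M
    isMatching = All.tabulate edge , subst Unique (sym (endpoints≡image (allFin m))) image-unique
      where
      edge : ∀ {e} → e ∈ M → adj G (proj₁ e) (proj₂ e) ≡ true
      edge e∈M with ∈-map⁻ (λ i → centre i , leaf i) e∈M
      ... | i , _ , refl = centre-leaf∈E i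

    f-matched : ∀ a → matched (f a) ≡ true
    f-matched a = ∈⇒matched (subst (f a ∈_) (sym (endpoints≡image (allFin m))) (∈-map⁺ f (∈-interleave-allFin a)))

    adj⇒nonisolated : ∀ {u v} → adj G u v ≡ true → d u ≢ 0
    adj⇒nonisolated uv∈E du≡0 with subst (1 ℕ.≤_) du≡0 (adj⇒deg≥1 G uv∈E)
    ... | ()

    every-edge-matched : EveryEdgeMatched
    every-edge-matched u v uv∈E with f-onto u (adj⇒nonisolated uv∈E)
    ... | a , refl = inj₁ (f-matched a)

    private
      ⌊≟⌋-sym : ∀ (i j : Fin m) → ⌊ i ≟ j ⌋ ≡ does (j ≟ i)
      ⌊≟⌋-sym i j with i ≟ j | j ≟ i
      ... | yes _ | yes _ = refl
      ... | no _ | no _ = refl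
      ... | yes i≡j | no j≢i = ⊥-elim (j≢i (sym i≡j))
      ... | no i≢j | yes j≡i = ⊥-elim (i≢j (sym j≡i))

      ∑-⌊≟⌋ : ∀ (i : Fin m) → ℕ∑.∑ (allFin m) (λ j → ℕ∑.[ ⌊ i ≟ j ⌋ ]? 1) ≡ 1
      ∑-⌊≟⌋ i = trans (ℕ∑.∑-cong (allFin m) (λ j → cong (ℕ∑.[_]? 1) (⌊≟⌋-sym i j)))
                      (ℕ∑.∑-point _≟_ (allFin m) (λ _ → 1) (allFin⁺ m) (∈-allFin i))

    deg-f : ∀ a → d (f a) ≡ ℕ∑.∑ domain (λ b → ℕ∑.[ coronaAdj H a b ]? 1)
    deg-f a = begin
      d (f a)
        ≡⟨ deg≡count G (f a) ⟩
      count V (adj G (f a))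
        ≡⟨ ℕ∑.∑-cong V neighbours-in-image ⟩
      ℕ∑.∑ V (λ x → ℕ∑.[ does (x ∈? image) ]? ℕ∑.[ adj G (f a) x ]? 1)
        ≡⟨ ℕ∑.∑-∈? _≟_ V (allFin⁺ n) ∈-allFin image _ image-unique ⟩
      ℕ∑.∑ image (λ x → ℕ∑.[ adj G (f a) x ]? 1)
        ≡⟨ ℕ∑.∑-map f domain _ ⟩
      ℕ∑.∑ domain (λ b → ℕ∑.[ adj G (f a) (f b) ]? 1)
        ≡⟨ ℕ∑.∑-cong domain (λ b → cong (ℕ∑.[_]? 1) (f-adj a b)) ⟩
      ℕ∑.∑ domain (λ b → ℕ∑.[ coronaAdj H a b ]? 1) ∎
      where
      open ≡-Reasoning
      neighbours-in-image : ∀ x → ℕ∑.[ adj G (f a) x ]? 1 ≡ ℕ∑.[ does (x ∈? image) ]? ℕ∑.[ adj G (f a) x ]? 1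
      neighbours-in-image x with adj G (f a) x in fa-x∈E
      ... | false = sym (ℕ∑.[]?-ε (does (x ∈? image)))
      ... | true with f-onto x (adj⇒nonisolated (trans (adj-sym G x (f a)) fa-x∈E))
      ...   | b , refl rewrite dec-true (f b ∈? image) (∈-map⁺ f (∈-interleave-allFin b)) = refl

    deg-centre : ∀ i → d (centre i) ≡ 3
    deg-centre i = begin
      d (centre i)
        ≡⟨ deg-f (inj₁ i) ⟩
      ℕ∑.∑ domain (λ b → ℕ∑.[ coronaAdj H (inj₁ i) b ]? 1)
        ≡⟨ ∑-interleave (allFin m) (λ b → ℕ∑.[ coronaAdj H (inj₁ i) b ]? 1) ⟩
      count (allFin m) (adj H i) ℕ.+ ℕ∑.∑ (allFin m) (λ j → ℕ∑.[ ⌊ i ≟ j ⌋ ]? 1)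
        ≡⟨ cong₂ ℕ._+_ (trans (sym (deg≡count H i)) (H-2-regular i)) (∑-⌊≟⌋ i) ⟩
      3 ∎
      where open ≡-Reasoning

    deg-leaf : ∀ i → d (leaf i) ≡ 1
    deg-leaf i = begin
      d (leaf i)
        ≡⟨ deg-f (inj₂ i) ⟩
      ℕ∑.∑ domain (λ b → ℕ∑.[ coronaAdj H (inj₂ i) b ]? 1)
        ≡⟨ ∑-interleave (allFin m) (λ b → ℕ∑.[ coronaAdj H (inj₂ i) b ]? 1) ⟩
      ℕ∑.∑ (allFin m) (λ j → ℕ∑.[ ⌊ i ≟ j ⌋ ]? 1) ℕ.+ ℕ∑.∑ (allFin m) (λ _ → 0)
        ≡⟨ cong₂ ℕ._+_ (∑-⌊≟⌋ i) (ℕ∑.∑-ε (allFin m)) ⟩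
      1 ∎
      where open ≡-Reasoning

    private
      leaf-centre∈E : ∀ i → adj G (leaf i) (centre i) ≡ true
      leaf-centre∈E i = trans (adj-sym G (leaf i) (centre i)) (centre-leaf∈E i)

      others-of-centre : ∀ i → count V (others (centre i) (leaf i)) ≡ 2
      others-of-centre i = ℕ.suc-injective (trans (sym (deg-split (centre-leaf∈E i))) (deg-centre i))

      others-of-leaf : ∀ i → count V (others (leaf i) (centre i)) ≡ 0
      others-of-leaf i = ℕ.suc-injective (trans (sym (deg-split (leaf-centre∈E i))) (deg-leaf i))

      received-centre : ∀ i → received (centre i) ≡ guaranteed (centre i) (leaf i)
      received-centre i = received≡guaranteed (centre-leaf∈E i) (f-matched (inj₁ i)) (f-matched (inj₂ i)) exact
        where
        exact : ∀ v → others (centre i) (leaf i) v ≡ true → σ (centre i) v ≡ minCharge (d (centre i))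
        exact v cv∈others with f-onto v (adj⇒nonisolated (trans (adj-sym G v (centre i)) (others⇒adj {centre i} {leaf i} {v} cv∈others)))
        ... | inj₁ j , refl rewrite f-matched (inj₁ i) | f-matched (inj₁ j) | deg-centre i | deg-centre j = refl
        ... | inj₂ j , refl with i ≟ j | f-adj (inj₁ i) (inj₂ j)
        ...   | yes refl | _ = ⊥-elim (others⇒≢ {centre i} {leaf i} {leaf i} cv∈others refl)
        ...   | no _ | ci-lj∉E with trans (sym ci-lj∉E) (others⇒adj {centre i} {leaf i} {leaf j} cv∈others)
        ...     | ()

      received-leaf : ∀ i → received (leaf i) ≡ guaranteed (leaf i) (centre i)
      received-leaf i = received≡guaranteed (leaf-centre∈E i) (f-matched (inj₂ i)) (f-matched (inj₁ i)) no-others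
        where
        no-others : ∀ v → others (leaf i) (centre i) v ≡ true → σ (leaf i) v ≡ minCharge (d (leaf i))
        no-others v lv∈others with subst (1 ℕ.≤_) (others-of-leaf i) (count≥1 V (others (leaf i) (centre i)) (∈-allFin v) lv∈others)
        ... | ()

    edgeTotal-exact : ∀ i → (received (centre i) +K received (leaf i)) ≡ c₃
    edgeTotal-exact i = begin
      received (centre i) +K received (leaf i)
        ≡⟨ cong₂ _+K_ (received-centre i) (received-leaf i) ⟩
      guaranteed (centre i) (leaf i) +K guaranteed (leaf i) (centre i)
        ≡⟨ sym (edgeBound≡guaranteed (centre-leaf∈E i)) ⟩
      edgeBound (count V (others (centre i) (leaf i))) (count V (others (leaf i) (centre i)))
        ≡⟨ cong₂ edgeBound (others-of-centre i) (others-of-leaf i) ⟩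
      edgeBound 2 0
        ≡⟨ edgeBound-pendant ⟩
      c₃ ∎
      where open ≡-Reasoning

    open MatchingBound G M Δ≤3 isMatching every-edge-matched using (edgeTotal; randic≡∑edgeTotal)

    randic≡m·c₃ : randic G ≡ (m ·K c₃)
    randic≡m·c₃ = begin
      randic G
        ≡⟨ randic≡∑edgeTotal ⟩
      ∑ M edgeTotal
        ≡⟨ ∑-map (λ i → centre i , leaf i) (allFin m) edgeTotal ⟩
      ∑ (allFin m) (λ i → received (centre i) +K received (leaf i))
        ≡⟨ ∑-cong (allFin m) edgeTotal-exact ⟩
      ∑ (allFin m) (λ _ → c₃)
        ≡⟨ ∑-const (allFin m) c₃ ⟩
      length (allFin m) ·K c₃
        ≡⟨ cong (_·K c₃) (length-tabulate id) ⟩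
      m ·K c₃ ∎
      where open ≡-Reasoning

    length-M : length M ≡ m
    length-M = trans (length-map _ (allFin m)) (length-tabulate id)

open OrderOnK
open ChargeTable
open MaximumMatchings
open Coronas

theorem3p1 : ∀ {n} (G : Graph n) → MaxDegreeAtMost G 3 →
    (k : ℕ) → IsMatchingNumber G k →
    ((k ·K c₃) ≤K randic G)
    × ((randic G ≡ (k ·K c₃)) ⇔ NonIsolatedPartIsCoronaOf2Regular G)
theorem3p1 G Δ≤3 k ((M , isMatching , |M|≡k) , maximum) = bound , mk⇔ equality⇒corona corona⇒equality
  where
  every-edge-matched = maximum⇒everyEdgeMatched G M isMatching
    (λ M′ isMatching′ → subst (length M′ ≤_) (sym |M|≡k) (maximum M′ isMatching′))
  open MatchingBound G M Δ≤3 isMatching every-edge-matched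

  bound : (k ·K c₃) ≤K randic G
  bound = subst (λ l → (l ·K c₃) ≤K randic G) |M|≡k length·c₃≤randic

  equality⇒corona : randic G ≡ (k ·K c₃) → NonIsolatedPartIsCoronaOf2Regular G
  equality⇒corona randic≡ = TightMatching.isCorona G M isMatching every-edge-matched
    (randic≡length·c₃⇒tight (trans randic≡ (cong (_·K c₃) (sym |M|≡k))))

  corona⇒equality : NonIsolatedPartIsCoronaOf2Regular G → randic G ≡ (k ·K c₃)
  corona⇒equality (m , H , H-2-regular , f , f-injective , _ , f-onto , f-adj) = trans randic≡m·c₃ (cong (_·K c₃) m≡k)
    where
    open CoronaRandic G Δ≤3 m H H-2-regular f f-injective f-onto f-adj
      using (randic≡m·c₃; length-M) renaming (M to M′; isMatching to isMatching′)
    m≡k : m ≡ k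
    m≡k = ≤-antisym (subst (_≤ k) length-M (maximum M′ isMatching′))
                      (·K-cancel-≤ c₃>0 (subst ((k ·K c₃) ≤K_) randic≡m·c₃ bound))
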